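{- Let $n\ge1$ and $q,r\ge0$ with $q+r\le n-1$. Let $Y_{n,q,r}$ be the number of triples $(\Gamma,S,T)$ where $\Gamma$ is a configuration of size $n$, $S$ is a set of $q$ pairs of $\Gamma$ lying entirely to the left of the given pair, and $T$ is a set of $r$ pairs of $\Gamma$ lying entirely to the right of the given pair (equivalently $Y_{n,q,r}=\sum_\Gamma\binom{L(\Gamma)}{q}\binom{R(\Gamma)}{r}$ with $L,R$ the numbers of such pairs). Then $$Y_{n,q,r}=\sum_{d=0}^{2n-2-2q-2r}\ \sum_{\ell=2q}^{2n-d-2-2r}\binom{\ell}{2q}(2q-1)!!\binom{2n-d-\ell-2}{2r}(2r-1)!!\,(2n-2q-2r-3)!!,$$ with the convention $(-1)!!=1$.
   Context: Fix $n\ge1$. A configuration (of size $n$) is a perfect matching of the $2n$ points $1,2,\dots,2n$ (laid out on a line) into $n$ unordered pairs, together with one distinguished pair, called the given pair; the other $n-1$ pairs are treated as indistinguishable, so there are $n\,(2n-1)!!$ configurations. Let the given pair be $\{g<h\}$. Another pair $\{a<b\}$ lies entirely to the left of the given pair if $b<g$, and entirely to the right if $a>h$. -}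

module Defs where

open import Data.Nat using (ℕ; zero; suc; _+_; _*_; _∸_; _≡ᵇ_; _<ᵇ_)
open import Data.Nat.Combinatorics using (_C_)
open import Data.Bool using (Bool; true; false; if_then_else_; _∧_; not)
open import Data.Fin using (Fin; toℕ)
open import Data.Vec using (Vec; []; _∷_; lookup)
open import Data.List using (List; []; _∷_; [_]; map; concatMap; upTo; length)
open import Data.List.Base using (foldr)
open import Data.Nat.ListAction using (sum)
open import Data.List using () renaming (allFin to allFinL)

-- (2k-1)!! = 1 * 3 * ... * (2k-1), with (-1)!! = 1 (k = 0).
oddDF : ℕ → ℕ
oddDF zero    = 1
oddDF (suc k) = (2 * k + 1) * oddDF k

-- Σ_{i=a}^{b} f i  (empty when b < a)
sumRange : ℕ → ℕ → (ℕ → ℕ) → ℕ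
sumRange a b f = sum (map (λ i → f (a + i)) (upTo (suc b ∸ a)))

allB : {A : Set} → (A → Bool) → List A → Bool
allB f = foldr (λ x b → f x ∧ b) true

countB : {A : Set} → (A → Bool) → List A → ℕ
countB f = foldr (λ x c → if f x then suc c else c) 0

allVecs : (k m : ℕ) → List (Vec (Fin m) k)
allVecs zero    m = [ [] ]
allVecs (suc k) m = concatMap (λ i → map (i ∷_) (allVecs k m)) (allFinL m)

-- The 2n points are Fin (2 * n) (point i of Fin is the point i+1 of the paper).
-- A perfect matching is encoded by its partner function p (a vector):
-- a fixed-point-free involution on the points.
isMatching : {N : ℕ} → Vec (Fin N) N → Bool
isMatching {N} p =
  allB (λ i → (toℕ (lookup p (lookup p i)) ≡ᵇ toℕ i) ∧ not (toℕ (lookup p i) ≡ᵇ toℕ i))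
      (allFinL N)

-- Given pair {g < h} with h = p g.  L = number of pairs {a<b} with b < g
-- (counted by their larger endpoint b); R = number of pairs {a<b} with a > h
-- (counted by their smaller endpoint a).
leftCount : {N : ℕ} → Vec (Fin N) N → Fin N → ℕ
leftCount {N} p g =
  countB (λ b → (toℕ (lookup p b) <ᵇ toℕ b) ∧ (toℕ b <ᵇ toℕ g)) (allFinL N)

rightCount : {N : ℕ} → Vec (Fin N) N → Fin N → ℕ
rightCount {N} p g =
  countB (λ a → (toℕ a <ᵇ toℕ (lookup p a)) ∧ (toℕ (lookup p g) <ᵇ toℕ a)) (allFinL N)

Y : ℕ → ℕ → ℕ → ℕ
Y n q r =
  sum (map (λ p → if isMatching p
                  then sum (map (λ g → if toℕ g <ᵇ toℕ (lookup p g)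
                                        then (leftCount p g C q) * (rightCount p g C r)
                                        else 0)
                                (allFinL (2 * n)))
                  else 0)
           (allVecs (2 * n) (2 * n)))

-- Right-hand side of the formula.
-- (2q-1)!! = oddDF q, (2r-1)!! = oddDF r, (2n-2q-2r-3)!! = oddDF (n ∸ 1 ∸ q ∸ r)
formula : ℕ → ℕ → ℕ → ℕ
formula n q r =
  sumRange 0 (2 * n ∸ 2 ∸ 2 * q ∸ 2 * r) λ d →
    sumRange (2 * q) (2 * n ∸ d ∸ 2 ∸ 2 * r) λ ℓ →
      (ℓ C (2 * q)) * oddDF q * ((2 * n ∸ d ∸ ℓ ∸ 2) C (2 * r)) * oddDF r
        * oddDF (n ∸ 1 ∸ q ∸ r)

module Submission where

-- Proposition 2.2.  Fix the given pair {g < h}: the pairs left of it are the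
-- pairs inside {x < g}, those right of it the pairs inside {x > h}, and the
-- other pairs form any perfect matching of the remaining points.  The key
-- lemma `pairSum-closed` states that for sets A, B disjoint inside V,
--   Σ_{p matching of V} C(#pairs of p in A, q) · C(#pairs of p in B, r)
--     = part |A ∩ V| q · part |B ∩ V| r · perf (|V| - 2q - 2r),
-- where part a q = C(a, 2q)(2q-1)!! and perf k counts perfect matchings of k
-- points.  It is proved by induction: for u ∈ A ∩ V, Pascal's rule separates
-- the matchings pairing u inside A, which correspond to matchings of V ∖ u ∖ j
-- for the partner j.  So Y n q r = Σ_{g<h} part g q · part (2n-1-h) r ·
-- perf (2n-2-2q-2r), and substituting h = g + 1 + d, ℓ = g (terms with ℓ < 2q
-- or fewer than 2r points right of h vanish) gives the formula.

open import Defs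
open import Data.Nat using (ℕ; zero; suc; _+_; _*_; _∸_; _≤_; _<_; _≡ᵇ_; _<ᵇ_; z≤n; s≤s; z<s; s<s; _⊓_; _≤?_; _<?_)
open import Data.Nat.Properties
open import Data.Nat.Combinatorics using (_C_; nCk≡nC[n∸k]; nCn≡1; nCk+nC[k+1]≡[n+1]C[k+1]; k>n⇒nCk≡0)
open import Data.Nat.ListAction using (sum)
open import Data.Nat.ListAction.Properties using (sum-++)
open import Data.Nat.Tactic.RingSolver using (solve-∀)
open import Data.Bool using (Bool; true; false; if_then_else_; _∧_; not; T)
open import Data.Bool.Properties using (∧-identityʳ; ∧-zeroʳ; ∧-comm; ∧-assoc)
open import Data.Fin using (Fin; toℕ) renaming (zero to fz; suc to fs; _≟_ to _≟F_)
open import Data.Fin.Properties using (toℕ-injective; toℕ<n)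
open import Data.Vec using (Vec; []; _∷_; lookup; _[_]≔_; tabulate)
open import Data.Vec.Properties using (lookup∘update; lookup∘update′; tabulate∘lookup; tabulate-cong; lookup∘tabulate)
open import Data.List using (List; []; _∷_; map; concatMap; _++_; applyUpTo) renaming (allFin to allFinL; tabulate to tabL)
open import Data.List.Properties using (map-∘; map-cong; map-++)
open import Data.Product using (Σ; _×_; _,_; proj₁; proj₂)
open import Data.Sum using (_⊎_; inj₁; inj₂)
open import Data.Empty using (⊥; ⊥-elim)
open import Relation.Nullary using (¬_; yes; no)
open import Relation.Binary.PropositionalEquality hiding ([_])
open ≡-Reasoning

∧-l : ∀ {a b} → a ∧ b ≡ true → a ≡ true
∧-l {true} e = refl

∧-r : ∀ {a b} → a ∧ b ≡ true → b ≡ true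
∧-r {true} e = e

∧-i : ∀ {a b} → a ≡ true → b ≡ true → a ∧ b ≡ true
∧-i refl refl = refl

not-t : ∀ {a} → not a ≡ true → a ≡ false
not-t {false} e = refl

not-i : ∀ {a} → a ≡ false → not a ≡ true
not-i refl = refl

t≢f : ∀ {b} → b ≡ true → b ≡ false → ⊥
t≢f refl ()

bool-iff : ∀ {a b} → (a ≡ true → b ≡ true) → (b ≡ true → a ≡ true) → a ≡ b
bool-iff {true} {true} f g = refl
bool-iff {true} {false} f g = sym (f refl)
bool-iff {false} {true} f g = g refl
bool-iff {false} {false} f g = refl

𝟙 : Bool → ℕ
𝟙 true = 1
𝟙 false = 0

𝟙-∧ : ∀ a b → 𝟙 (a ∧ b) ≡ 𝟙 a * 𝟙 b
𝟙-∧ true b = sym (+-identityʳ (𝟙 b))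
𝟙-∧ false b = refl

𝟙-∧-* : ∀ a b (z : ℕ) → 𝟙 (a ∧ b) * z ≡ 𝟙 b * (𝟙 a * z)
𝟙-∧-* a b z = trans (cong (_* z) (𝟙-∧ a b)) (reorder (𝟙 a) (𝟙 b) z)
  where reorder : ∀ x y z → (x * y) * z ≡ y * (x * z)
        reorder = solve-∀

𝟙-split : ∀ b (x : ℕ) → x ≡ 𝟙 b * x + 𝟙 (not b) * x
𝟙-split true x = sym (trans (+-identityʳ (x + 0)) (+-identityʳ x))
𝟙-split false x = sym (+-identityʳ x)

if-𝟙 : ∀ b x → (if b then x else 0) ≡ 𝟙 b * x
if-𝟙 true x = sym (+-identityʳ x)
if-𝟙 false x = refl

𝟙𝟙-cong : ∀ b1 b2 b3 b4 (z : ℕ) → (b1 ≡ true → b2 ≡ true → (b3 ≡ true) × (b4 ≡ true)) →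
  (b3 ≡ true → b4 ≡ true → (b1 ≡ true) × (b2 ≡ true)) → 𝟙 b2 * (𝟙 b1 * z) ≡ 𝟙 b4 * (𝟙 b3 * z)
𝟙𝟙-cong true true true true z h1 h2 = refl
𝟙𝟙-cong true true b3 b4 z h1 h2 with h1 refl refl
... | refl , refl = refl
𝟙𝟙-cong b1 b2 true true z h1 h2 with h2 refl refl
... | refl , refl = refl
𝟙𝟙-cong false b2 false b4 z h1 h2 = trans (*-zeroʳ (𝟙 b2)) (sym (*-zeroʳ (𝟙 b4)))
𝟙𝟙-cong false b2 true false z h1 h2 = *-zeroʳ (𝟙 b2)
𝟙𝟙-cong true false false b4 z h1 h2 = sym (*-zeroʳ (𝟙 b4))
𝟙𝟙-cong true false true false z h1 h2 = refl

true⇒T : ∀ {b} → b ≡ true → T b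
true⇒T refl = _

T⇒true : ∀ {b} → T b → b ≡ true
T⇒true {true} _ = refl

<ᵇ-true⇒< : ∀ m n → (m <ᵇ n) ≡ true → m < n
<ᵇ-true⇒< m n e = <ᵇ⇒< m n (true⇒T e)

<⇒<ᵇ-true : ∀ {m n} → m < n → (m <ᵇ n) ≡ true
<⇒<ᵇ-true p = T⇒true (<⇒<ᵇ p)

eqF : {N : ℕ} → Fin N → Fin N → Bool
eqF x y = toℕ x ≡ᵇ toℕ y

eqF-true : ∀ {N} {x y : Fin N} → eqF x y ≡ true → x ≡ y
eqF-true {x = x} {y} e = toℕ-injective (≡ᵇ⇒≡ (toℕ x) (toℕ y) (true⇒T e))

eqF-i : ∀ {N} {x y : Fin N} → x ≡ y → eqF x y ≡ true
eqF-i {x = x} refl = T⇒true (≡⇒≡ᵇ (toℕ x) (toℕ x) refl)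

eqF-refl : ∀ {N} (x : Fin N) → eqF x x ≡ true
eqF-refl x = eqF-i {x = x} refl

eqF-sym : ∀ {N} (x y : Fin N) → eqF x y ≡ eqF y x
eqF-sym x y = bool-iff (λ e → eqF-i (sym (eqF-true {x = x} e))) (λ e → eqF-i (sym (eqF-true {x = y} e)))

eqF-false : ∀ {N} {x y : Fin N} → eqF x y ≡ false → x ≢ y
eqF-false {x = x} e refl = t≢f (eqF-refl x) e

≢-eqF : ∀ {N} {x y : Fin N} → x ≢ y → eqF x y ≡ false
≢-eqF {x = x} {y} ne with eqF x y in e
... | true = ⊥-elim (ne (eqF-true e))
... | false = refl

Σl : {A : Set} → List A → (A → ℕ) → ℕ
Σl xs f = sum (map f xs)

ΣF : {N : ℕ} → (Fin N → ℕ) → ℕ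
ΣF {zero} f = 0
ΣF {suc N} f = f fz + ΣF (λ i → f (fs i))

Σ< : ℕ → (ℕ → ℕ) → ℕ
Σ< zero f = 0
Σ< (suc N) f = f 0 + Σ< N (λ i → f (suc i))

interchange : ∀ a b c d → (a + b) + (c + d) ≡ (a + c) + (b + d)
interchange = solve-∀

Σl-cong : ∀ {A : Set} (xs : List A) {f g : A → ℕ} → (∀ x → f x ≡ g x) → Σl xs f ≡ Σl xs g
Σl-cong xs eq = cong sum (map-cong eq xs)

Σl-+ : ∀ {A : Set} (xs : List A) (f g : A → ℕ) → Σl xs (λ x → f x + g x) ≡ Σl xs f + Σl xs g
Σl-+ [] f g = refl
Σl-+ (x ∷ xs) f g = trans (cong (f x + g x +_) (Σl-+ xs f g)) (interchange (f x) (g x) _ _)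

Σl-* : ∀ {A : Set} (xs : List A) (c : ℕ) (f : A → ℕ) → Σl xs (λ x → c * f x) ≡ c * Σl xs f
Σl-* [] c f = sym (*-zeroʳ c)
Σl-* (x ∷ xs) c f = trans (cong (c * f x +_) (Σl-* xs c f)) (sym (*-distribˡ-+ c (f x) _))

Σl-0 : ∀ {A : Set} (xs : List A) (f : A → ℕ) → (∀ x → f x ≡ 0) → Σl xs f ≡ 0
Σl-0 [] f h = refl
Σl-0 (x ∷ xs) f h rewrite h x = Σl-0 xs f h

Σl-swap : ∀ {A B : Set} (xs : List A) (ys : List B) (f : A → B → ℕ) →
  Σl xs (λ x → Σl ys (f x)) ≡ Σl ys (λ y → Σl xs (λ x → f x y))
Σl-swap [] ys f = sym (Σl-0 ys _ (λ _ → refl))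
Σl-swap (x ∷ xs) ys f =
  trans (cong (Σl ys (f x) +_) (Σl-swap xs ys f)) (sym (Σl-+ ys (f x) _))

Σl-concatMap : ∀ {A B : Set} (g : A → List B) (xs : List A) (F : B → ℕ) →
  Σl (concatMap g xs) F ≡ Σl xs (λ x → Σl (g x) F)
Σl-concatMap g [] F = refl
Σl-concatMap g (x ∷ xs) F = begin
  Σl (g x ++ concatMap g xs) F                 ≡⟨ cong sum (map-++ F (g x) (concatMap g xs)) ⟩
  sum (map F (g x) ++ map F (concatMap g xs))  ≡⟨ sum-++ (map F (g x)) _ ⟩
  Σl (g x) F + Σl (concatMap g xs) F           ≡⟨ cong (Σl (g x) F +_) (Σl-concatMap g xs F) ⟩
  Σl (g x) F + Σl xs (λ y → Σl (g y) F)        ∎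

Σl-map : ∀ {A B : Set} (h : A → B) (xs : List A) (F : B → ℕ) → Σl (map h xs) F ≡ Σl xs (λ x → F (h x))
Σl-map h xs F = cong sum (sym (map-∘ xs))

Σl-tabulate : ∀ {N M : ℕ} (h : Fin M → Fin N) (f : Fin N → ℕ) → Σl (tabL h) f ≡ ΣF (λ i → f (h i))
Σl-tabulate {M = zero} h f = refl
Σl-tabulate {M = suc M} h f = cong (f (h fz) +_) (Σl-tabulate (λ i → h (fs i)) f)

Σl-allFin : ∀ {N : ℕ} (f : Fin N → ℕ) → Σl (allFinL N) f ≡ ΣF f
Σl-allFin f = Σl-tabulate (λ i → i) f

ΣF-cong : ∀ {N} {f g : Fin N → ℕ} → (∀ x → f x ≡ g x) → ΣF f ≡ ΣF g
ΣF-cong {zero} eq = refl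
ΣF-cong {suc N} eq = cong₂ _+_ (eq fz) (ΣF-cong (λ i → eq (fs i)))

ΣF-+ : ∀ {N} (f g : Fin N → ℕ) → ΣF (λ x → f x + g x) ≡ ΣF f + ΣF g
ΣF-+ {zero} f g = refl
ΣF-+ {suc N} f g =
  trans (cong (f fz + g fz +_) (ΣF-+ (λ i → f (fs i)) (λ i → g (fs i)))) (interchange (f fz) (g fz) _ _)

ΣF-* : ∀ {N} (c : ℕ) (f : Fin N → ℕ) → ΣF (λ x → c * f x) ≡ c * ΣF f
ΣF-* {zero} c f = sym (*-zeroʳ c)
ΣF-* {suc N} c f = trans (cong (c * f fz +_) (ΣF-* c (λ i → f (fs i)))) (sym (*-distribˡ-+ c (f fz) _))

ΣF-0 : ∀ {N} (f : Fin N → ℕ) → (∀ x → f x ≡ 0) → ΣF f ≡ 0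
ΣF-0 {zero} f h = refl
ΣF-0 {suc N} f h rewrite h fz = ΣF-0 (λ i → f (fs i)) (λ i → h (fs i))

ΣF-swap : ∀ {N M} (f : Fin N → Fin M → ℕ) → ΣF (λ x → ΣF (f x)) ≡ ΣF (λ y → ΣF (λ x → f x y))
ΣF-swap {zero} {M} f = sym (ΣF-0 {M} (λ _ → 0) (λ _ → refl))
ΣF-swap {suc N} f = trans (cong (ΣF (f fz) +_) (ΣF-swap (λ i → f (fs i)))) (sym (ΣF-+ (f fz) _))

Σl-ΣF-swap : ∀ {A : Set} {N} (xs : List A) (f : A → Fin N → ℕ) →
  Σl xs (λ x → ΣF (f x)) ≡ ΣF (λ i → Σl xs (λ x → f x i))
Σl-ΣF-swap {N = N} xs f = begin
  Σl xs (λ x → ΣF (f x))                   ≡⟨ Σl-cong xs (λ x → sym (Σl-allFin (f x))) ⟩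
  Σl xs (λ x → Σl (allFinL N) (f x))       ≡⟨ Σl-swap xs (allFinL N) f ⟩
  Σl (allFinL N) (λ i → Σl xs (λ x → f x i)) ≡⟨ Σl-allFin (λ i → Σl xs (λ x → f x i)) ⟩
  ΣF (λ i → Σl xs (λ x → f x i))           ∎

ΣF-δ : ∀ {N} (a : Fin N) (f : Fin N → ℕ) → ΣF (λ i → 𝟙 (eqF i a) * f i) ≡ f a
ΣF-δ {suc N} fz f =
  trans (cong₂ _+_ (+-identityʳ (f fz)) (ΣF-0 (λ i → 𝟙 (eqF (fs i) fz) * f (fs i)) (λ _ → refl))) (+-identityʳ (f fz))
ΣF-δ {suc N} (fs a) f = ΣF-δ a (λ i → f (fs i))

ΣF-remove : ∀ {N} (u : Fin N) (f : Fin N → ℕ) → ΣF f ≡ f u + ΣF (λ i → 𝟙 (not (eqF i u)) * f i)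
ΣF-remove u f = begin
  ΣF f                                                          ≡⟨ ΣF-cong (λ i → 𝟙-split (eqF i u) (f i)) ⟩
  ΣF (λ i → 𝟙 (eqF i u) * f i + 𝟙 (not (eqF i u)) * f i)        ≡⟨ ΣF-+ (λ i → 𝟙 (eqF i u) * f i) _ ⟩
  ΣF (λ i → 𝟙 (eqF i u) * f i) + ΣF (λ i → 𝟙 (not (eqF i u)) * f i)
    ≡⟨ cong (_+ ΣF (λ i → 𝟙 (not (eqF i u)) * f i)) (ΣF-δ u f) ⟩
  f u + ΣF (λ i → 𝟙 (not (eqF i u)) * f i)                      ∎

ΣF-toℕ : ∀ {N} (f : ℕ → ℕ) → ΣF {N} (λ x → f (toℕ x)) ≡ Σ< N f
ΣF-toℕ {zero} f = refl
ΣF-toℕ {suc N} f = cong (f 0 +_) (ΣF-toℕ {N} (λ i → f (suc i)))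

ΣVec : (k m : ℕ) → (Vec (Fin m) k → ℕ) → ℕ
ΣVec k m F = Σl (allVecs k m) F

ΣVec-cong : ∀ k m {f g : Vec (Fin m) k → ℕ} → (∀ x → f x ≡ g x) → ΣVec k m f ≡ ΣVec k m g
ΣVec-cong k m eq = Σl-cong (allVecs k m) eq

eqV : ∀ {k m} → Vec (Fin m) k → Vec (Fin m) k → Bool
eqV [] [] = true
eqV (x ∷ xs) (y ∷ ys) = eqF x y ∧ eqV xs ys

eqV-true : ∀ {k m} {x y : Vec (Fin m) k} → eqV x y ≡ true → x ≡ y
eqV-true {x = []} {[]} e = refl
eqV-true {x = x ∷ xs} {y ∷ ys} e with eqF x y in e1
... | true = cong₂ _∷_ (eqF-true e1) (eqV-true e)

eqV-refl : ∀ {k m} (x : Vec (Fin m) k) → eqV x x ≡ true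
eqV-refl [] = refl
eqV-refl (x ∷ xs) rewrite eqF-refl x = eqV-refl xs

-- Every vector occurs exactly once in `allVecs`: the delta sum picks out g a.
ΣVec-δ : ∀ k m (a : Vec (Fin m) k) (g : Vec (Fin m) k → ℕ) → ΣVec k m (λ y → 𝟙 (eqV y a) * g y) ≡ g a
ΣVec-δ zero m [] g = trans (+-identityʳ _) (+-identityʳ _)
ΣVec-δ (suc k) m (a ∷ as) g = begin
  Σl (concatMap (λ i → map (i ∷_) (allVecs k m)) (allFinL m)) F
    ≡⟨ Σl-concatMap (λ i → map (i ∷_) (allVecs k m)) (allFinL m) F ⟩
  Σl (allFinL m) (λ i → Σl (map (i ∷_) (allVecs k m)) F)
    ≡⟨ Σl-cong (allFinL m) (λ i → Σl-map (i ∷_) (allVecs k m) F) ⟩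
  Σl (allFinL m) (λ i → ΣVec k m (λ v → F (i ∷ v)))
    ≡⟨ Σl-allFin (λ i → ΣVec k m (λ v → F (i ∷ v))) ⟩
  ΣF (λ i → ΣVec k m (λ v → F (i ∷ v)))
    ≡⟨ ΣF-cong headDelta ⟩
  ΣF (λ i → 𝟙 (eqF i a) * g (i ∷ as))
    ≡⟨ ΣF-δ a (λ i → g (i ∷ as)) ⟩
  g (a ∷ as) ∎
  where
  F : Vec (Fin m) (suc k) → ℕ
  F y = 𝟙 (eqV y (a ∷ as)) * g y
  headDelta : ∀ i → ΣVec k m (λ v → F (i ∷ v)) ≡ 𝟙 (eqF i a) * g (i ∷ as)
  headDelta i = begin
    ΣVec k m (λ v → F (i ∷ v))
      ≡⟨ ΣVec-cong k m (λ v → trans (cong (_* g (i ∷ v)) (𝟙-∧ (eqF i a) (eqV v as))) (*-assoc (𝟙 (eqF i a)) _ _)) ⟩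
    ΣVec k m (λ v → 𝟙 (eqF i a) * (𝟙 (eqV v as) * g (i ∷ v)))
      ≡⟨ Σl-* (allVecs k m) (𝟙 (eqF i a)) _ ⟩
    𝟙 (eqF i a) * ΣVec k m (λ v → 𝟙 (eqV v as) * g (i ∷ v))
      ≡⟨ cong (𝟙 (eqF i a) *_) (ΣVec-δ k m as (λ v → g (i ∷ v))) ⟩
    𝟙 (eqF i a) * g (i ∷ as) ∎

-- Reindexing along a bijection φ : {P} → {Q} with inverse ψ.  Writing each
-- side as a double sum over pairs (x, y) with y = φ x (equivalently x = ψ y)
-- and exchanging the order of summation.
reindex : ∀ k m (P Q : Vec (Fin m) k → Bool) (φ ψ : Vec (Fin m) k → Vec (Fin m) k) (F : Vec (Fin m) k → ℕ) →
  (∀ x → P x ≡ true → Q (φ x) ≡ true) → (∀ x → P x ≡ true → ψ (φ x) ≡ x) →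
  (∀ y → Q y ≡ true → P (ψ y) ≡ true) → (∀ y → Q y ≡ true → φ (ψ y) ≡ y) →
  ΣVec k m (λ x → 𝟙 (P x) * F x) ≡ ΣVec k m (λ y → 𝟙 (Q y) * F (ψ y))
reindex k m P Q φ ψ F pq pψφ qp qφψ = begin
  ΣVec k m (λ x → 𝟙 (P x) * F x)
    ≡⟨ ΣVec-cong k m asDoubleSum ⟩
  ΣVec k m (λ x → ΣVec k m (λ y → 𝟙 (eqV y (φ x)) * (𝟙 (P x) * F (ψ y))))
    ≡⟨ Σl-swap (allVecs k m) (allVecs k m) _ ⟩
  ΣVec k m (λ y → ΣVec k m (λ x → 𝟙 (eqV y (φ x)) * (𝟙 (P x) * F (ψ y))))
    ≡⟨ ΣVec-cong k m (λ y → ΣVec-cong k m (λ x → graphSymmetric x y)) ⟩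
  ΣVec k m (λ y → ΣVec k m (λ x → 𝟙 (eqV x (ψ y)) * (𝟙 (Q y) * F (ψ y))))
    ≡⟨ ΣVec-cong k m (λ y → ΣVec-δ k m (ψ y) (λ _ → 𝟙 (Q y) * F (ψ y))) ⟩
  ΣVec k m (λ y → 𝟙 (Q y) * F (ψ y)) ∎
  where
  asDoubleSum : ∀ x → 𝟙 (P x) * F x ≡ ΣVec k m (λ y → 𝟙 (eqV y (φ x)) * (𝟙 (P x) * F (ψ y)))
  asDoubleSum x with P x in e
  ... | true  = sym (trans (ΣVec-δ k m (φ x) (λ y → 1 * F (ψ y))) (cong (λ z → 1 * F z) (pψφ x e)))
  ... | false = sym (Σl-0 (allVecs k m) _ (λ y → *-zeroʳ (𝟙 (eqV y (φ x)))))
  -- P x ∧ y = φ x  holds iff  Q y ∧ x = ψ y  holds.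
  graphSymmetric : ∀ x y → 𝟙 (eqV y (φ x)) * (𝟙 (P x) * F (ψ y)) ≡ 𝟙 (eqV x (ψ y)) * (𝟙 (Q y) * F (ψ y))
  graphSymmetric x y = 𝟙𝟙-cong (P x) (eqV y (φ x)) (Q y) (eqV x (ψ y)) (F (ψ y)) forth back
    where
    forth : P x ≡ true → eqV y (φ x) ≡ true → (Q y ≡ true) × (eqV x (ψ y) ≡ true)
    forth px e = subst (λ z → (Q z ≡ true) × (eqV x (ψ z) ≡ true)) (sym (eqV-true e))
                   (pq x px , subst (λ z → eqV x z ≡ true) (sym (pψφ x px)) (eqV-refl x))
    back : Q y ≡ true → eqV x (ψ y) ≡ true → (P x ≡ true) × (eqV y (φ x) ≡ true)
    back qy e = subst (λ z → (P z ≡ true) × (eqV y (φ z) ≡ true)) (sym (eqV-true e))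
                  (qp y qy , subst (λ z → eqV y z ≡ true) (sym (qφψ y qy)) (eqV-refl y))

Endo : ℕ → Set
Endo N = Vec (Fin N) N

Pred : ℕ → Set
Pred N = Fin N → Bool

infixl 9 _!_
_!_ : ∀ {N} → Endo N → Fin N → Fin N
p ! i = lookup p i

vec-ext : ∀ {N} {x y : Endo N} → (∀ i → x ! i ≡ y ! i) → x ≡ y
vec-ext {x = x} {y} eq = trans (sym (tabulate∘lookup x)) (trans (tabulate-cong eq) (tabulate∘lookup y))

_∖_ : ∀ {N} → Pred N → Fin N → Pred N
(X ∖ u) x = X x ∧ not (eqF x u)

_∩_ : ∀ {N} → Pred N → Pred N → Pred N
(A ∩ V) x = A x ∧ V x

∖-t : ∀ {N} {X : Pred N} {u x} → (X ∖ u) x ≡ true → (X x ≡ true) × (x ≢ u)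
∖-t e = ∧-l e , eqF-false (not-t (∧-r e))

∖-i : ∀ {N} {X : Pred N} {u x} → X x ≡ true → x ≢ u → (X ∖ u) x ≡ true
∖-i e ne = ∧-i e (not-i (≢-eqF ne))

∖-ne : ∀ {N} (X : Pred N) {u x} → x ≢ u → (X ∖ u) x ≡ X x
∖-ne X {u} {x} ne rewrite ≢-eqF ne = ∧-identityʳ (X x)

∖-eq : ∀ {N} (X : Pred N) u → (X ∖ u) u ≡ false
∖-eq X u rewrite eqF-refl u = ∧-zeroʳ (X u)

size : ∀ {N} → Pred N → ℕ
size X = ΣF (λ x → 𝟙 (X x))

size-cong : ∀ {N} {X Y : Pred N} → (∀ x → X x ≡ Y x) → size X ≡ size Y
size-cong eq = ΣF-cong (λ x → cong 𝟙 (eq x))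

size-zero : ∀ {N} {X : Pred N} → (∀ x → X x ≡ false) → size X ≡ 0
size-zero {X = X} h = ΣF-0 (λ x → 𝟙 (X x)) (λ x → cong 𝟙 (h x))

size-remove : ∀ {N} (X : Pred N) u → X u ≡ true → size X ≡ suc (size (X ∖ u))
size-remove X u e = begin
  size X                                               ≡⟨ ΣF-remove u (λ x → 𝟙 (X x)) ⟩
  𝟙 (X u) + ΣF (λ x → 𝟙 (not (eqF x u)) * 𝟙 (X x))
    ≡⟨ cong₂ _+_ (cong 𝟙 e) (ΣF-cong (λ x → 𝟙-∧-swap (X x) (eqF x u))) ⟩
  suc (size (X ∖ u))                                   ∎
  where 𝟙-∧-swap : ∀ a b → 𝟙 (not b) * 𝟙 a ≡ 𝟙 (a ∧ not b)
        𝟙-∧-swap a b = trans (*-comm (𝟙 (not b)) (𝟙 a)) (sym (𝟙-∧ a (not b)))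

ΣF-𝟙-const : ∀ {N} (X : Pred N) (c : ℕ) → ΣF (λ j → 𝟙 (X j) * c) ≡ size X * c
ΣF-𝟙-const X c = trans (ΣF-cong (λ j → *-comm (𝟙 (X j)) c)) (trans (ΣF-* c (λ j → 𝟙 (X j))) (*-comm c (size X)))

search : ∀ {N} (X : Pred N) → (Σ (Fin N) (λ u → X u ≡ true)) ⊎ (∀ u → X u ≡ false)
search {zero} X = inj₂ (λ ())
search {suc N} X with X fz in e
... | true = inj₁ (fz , e)
... | false with search (λ i → X (fs i))
...   | inj₁ (u , eu) = inj₁ (fs u , eu)
...   | inj₂ h = inj₂ (λ { fz → e ; (fs i) → h i })

set2 : ∀ {N} → Fin N → Fin N → Fin N → Fin N → Endo N → Endo N
set2 u a j b p = (p [ u ]≔ a) [ j ]≔ b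

set2-j : ∀ {N} u a j b (p : Endo N) → set2 u a j b p ! j ≡ b
set2-j u a j b p = lookup∘update j (p [ u ]≔ a) b

set2-u : ∀ {N} u a j b (p : Endo N) → u ≢ j → set2 u a j b p ! u ≡ a
set2-u u a j b p ne = trans (lookup∘update′ ne (p [ u ]≔ a) b) (lookup∘update u p a)

set2-o : ∀ {N} u a j b (p : Endo N) {i} → i ≢ u → i ≢ j → set2 u a j b p ! i ≡ p ! i
set2-o u a j b p n1 n2 = trans (lookup∘update′ n2 (p [ u ]≔ a) b) (lookup∘update′ n1 p a)

addPair : ∀ {N} → Fin N → Fin N → Endo N → Endo N
addPair u j = set2 u j j u

removePair : ∀ {N} → Fin N → Fin N → Endo N → Endo N
removePair u j = set2 u u j j

PairedIn : ∀ {N} → Pred N → Endo N → Fin N → Set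
PairedIn V p i = (p ! (p ! i) ≡ i) × (p ! i ≢ i) × (V (p ! i) ≡ true)

MatchingOn : ∀ {N} → Pred N → Endo N → Set
MatchingOn V p = ∀ i → (V i ≡ true → PairedIn V p i) × (V i ≡ false → p ! i ≡ i)

matchingAt : ∀ {N} → Pred N → Endo N → Fin N → Bool
matchingAt V p i = if V i then (eqF (p ! (p ! i)) i ∧ not (eqF (p ! i) i)) ∧ V (p ! i) else eqF (p ! i) i

isMatchingOn : ∀ {N} → Pred N → Endo N → Bool
isMatchingOn {N} V p = allB (matchingAt V p) (allFinL N)

allB-tab : ∀ {N M} (f : Fin N → Bool) (g : Fin M → Fin N) → allB f (tabL g) ≡ true → ∀ i → f (g i) ≡ true
allB-tab f g e fz = ∧-l e
allB-tab f g e (fs i) = allB-tab f (λ k → g (fs k)) (∧-r e) i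

tab-allB : ∀ {N M} (f : Fin N → Bool) (g : Fin M → Fin N) → (∀ i → f (g i) ≡ true) → allB f (tabL g) ≡ true
tab-allB {M = zero} f g h = refl
tab-allB {M = suc M} f g h = ∧-i (h fz) (tab-allB f (λ k → g (fs k)) (λ i → h (fs i)))

matchingAt⇒ : ∀ {N} (V : Pred N) p i → matchingAt V p i ≡ true →
  (V i ≡ true → PairedIn V p i) × (V i ≡ false → p ! i ≡ i)
matchingAt⇒ V p i e with V i
... | false = (λ ()) , (λ _ → eqF-true e)
... | true = (λ _ → eqF-true (∧-l pairedB) , eqF-false (not-t (∧-r pairedB)) , ∧-r e) , (λ ())
  where pairedB : (eqF (p ! (p ! i)) i ∧ not (eqF (p ! i) i)) ≡ true
        pairedB = ∧-l e

⇒matchingAt : ∀ {N} (V : Pred N) p i →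
  (V i ≡ true → PairedIn V p i) × (V i ≡ false → p ! i ≡ i) → matchingAt V p i ≡ true
⇒matchingAt V p i (onV , offV) with V i
... | true = let (inv , noFix , inV) = onV refl in ∧-i (∧-i (eqF-i inv) (not-i (≢-eqF noFix))) inV
... | false = eqF-i (offV refl)

isMatchingOn⇒ : ∀ {N} {V : Pred N} {p} → isMatchingOn V p ≡ true → MatchingOn V p
isMatchingOn⇒ {V = V} {p} e i = matchingAt⇒ V p i (allB-tab (matchingAt V p) (λ k → k) e i)

⇒isMatchingOn : ∀ {N} {V : Pred N} {p} → MatchingOn V p → isMatchingOn V p ≡ true
⇒isMatchingOn {V = V} {p} h = tab-allB (matchingAt V p) (λ k → k) (λ i → ⇒matchingAt V p i (h i))

-- A pair {x, y} is counted once, at its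
-- endpoint which is larger for a Boolean strict total order `lt`; the number
-- of pairs does not depend on the order, but the counts `leftCount` and
-- `rightCount` of Defs use two different orders.

record BoolOrder {N : ℕ} (lt : Fin N → Fin N → Bool) : Set where
  field
    irr : ∀ x → lt x x ≡ false
    tot : ∀ x y → x ≢ y → 𝟙 (lt x y) + 𝟙 (lt y x) ≡ 1

pairsIn : ∀ {N} → (Fin N → Fin N → Bool) → Pred N → Endo N → ℕ
pairsIn lt A p = ΣF (λ x → 𝟙 ((lt (p ! x) x ∧ A x) ∧ A (p ! x)))

𝟙-∧∧ : ∀ l a b → 𝟙 ((l ∧ a) ∧ b) ≡ 𝟙 l * 𝟙 (a ∧ b)
𝟙-∧∧ l a b = trans (cong 𝟙 (∧-assoc l a b)) (𝟙-∧ l (a ∧ b))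

oneOrientation : ∀ {N} {lt : Fin N → Fin N → Bool} → BoolOrder lt → ∀ x y → x ≢ y → (z : ℕ) →
  𝟙 (lt x y) * z + 𝟙 (lt y x) * z ≡ z
oneOrientation {lt = lt} ord x y ne z = begin
  𝟙 (lt x y) * z + 𝟙 (lt y x) * z  ≡⟨ *-distribʳ-+ z (𝟙 (lt x y)) (𝟙 (lt y x)) ⟨
  (𝟙 (lt x y) + 𝟙 (lt y x)) * z    ≡⟨ cong (_* z) (BoolOrder.tot ord x y ne) ⟩
  1 * z                            ≡⟨ *-identityˡ z ⟩
  z                                ∎

ΣF-twoPoint : ∀ {N} {u w : Fin N} (f g : Fin N → ℕ) (c : ℕ) → u ≢ w →
  (∀ x → x ≢ u → x ≢ w → f x ≡ g x) → f u + f w ≡ c + (g u + g w) → ΣF f ≡ ΣF g + c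
ΣF-twoPoint {u = u} {w} f g c uw off atUW = +-cancelʳ-≡ (g u + g w) (ΣF f) (ΣF g + c) (begin
  ΣF f + (g u + g w)                   ≡⟨ cong (_+ (g u + g w)) (splitUW f) ⟩
  (f u + (f w + rest f)) + (g u + g w) ≡⟨ cong (λ R → (f u + (f w + R)) + (g u + g w)) (ΣF-cong restAgree) ⟩
  (f u + (f w + rest g)) + (g u + g w) ≡⟨ regroup (f u) (f w) (g u) (g w) (rest g) ⟩
  (g u + (g w + rest g)) + (f u + f w) ≡⟨ cong₂ _+_ (sym (splitUW g)) atUW ⟩
  ΣF g + (c + (g u + g w))             ≡⟨ +-assoc (ΣF g) c (g u + g w) ⟨
  ΣF g + c + (g u + g w)               ∎)
  where
  wu : w ≢ u
  wu e = uw (sym e)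
  rest : (Fin _ → ℕ) → ℕ
  rest h = ΣF (λ i → 𝟙 (not (eqF i w)) * (𝟙 (not (eqF i u)) * h i))
  splitUW : ∀ h → ΣF h ≡ h u + (h w + rest h)
  splitUW h = trans (ΣF-remove u h) (cong (h u +_) (trans (ΣF-remove w (λ i → 𝟙 (not (eqF i u)) * h i))
    (cong (_+ rest h) (trans (cong (λ b → 𝟙 (not b) * h w) (≢-eqF wu)) (+-identityʳ (h w))))))
  restAgree : ∀ x → 𝟙 (not (eqF x w)) * (𝟙 (not (eqF x u)) * f x) ≡ 𝟙 (not (eqF x w)) * (𝟙 (not (eqF x u)) * g x)
  restAgree x with eqF x u in e1 | eqF x w in e2
  ... | true | b = refl
  ... | false | true = refl
  ... | false | false = cong (λ z → 1 * (1 * z)) (off x (eqF-false e1) (eqF-false e2))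
  regroup : ∀ a b c d r → (a + (b + r)) + (c + d) ≡ (c + (d + r)) + (a + b)
  regroup = solve-∀

pairsIn-remove : ∀ {N} (lt : Fin N → Fin N → Bool) → BoolOrder lt → (V A : Pred N) (u : Fin N) → ∀ p →
  MatchingOn V p → V u ≡ true → A u ≡ true → pairsIn lt A p ≡ pairsIn lt (A ∖ u) p + 𝟙 (A (p ! u))
pairsIn-remove {N} lt ord V A u p hp Vu Au = ΣF-twoPoint f g (𝟙 (A w)) uw off atUW
  where
  w = p ! u
  pw : p ! w ≡ u
  pw = proj₁ (proj₁ (hp u) Vu)
  wu : w ≢ u
  wu = proj₁ (proj₂ (proj₁ (hp u) Vu))
  uw : u ≢ w
  uw e = wu (sym e)
  f g : Fin N → ℕ
  f x = 𝟙 ((lt (p ! x) x ∧ A x) ∧ A (p ! x))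
  g x = 𝟙 ((lt (p ! x) x ∧ (A ∖ u) x) ∧ (A ∖ u) (p ! x))
  gu : g u ≡ 0
  gu rewrite 𝟙-∧∧ (lt (p ! u) u) ((A ∖ u) u) ((A ∖ u) (p ! u)) | ∖-eq A u = *-zeroʳ (𝟙 (lt (p ! u) u))
  gw : g w ≡ 0
  gw rewrite 𝟙-∧∧ (lt (p ! w) w) ((A ∖ u) w) ((A ∖ u) (p ! w)) | pw | ∖-eq A u | ∧-zeroʳ ((A ∖ u) w) =
    *-zeroʳ (𝟙 (lt u w))
  off : ∀ x → x ≢ u → x ≢ w → f x ≡ g x
  off x xu xw = cong₂ (λ a b → 𝟙 ((lt (p ! x) x ∧ a) ∧ b)) (sym (∖-ne A xu)) (sym (∖-ne A pxu))
    where
    pxu : p ! x ≢ u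
    pxu e with V x in ev
    ... | true = xw (trans (sym (proj₁ (proj₁ (hp x) ev))) (cong (p !_) e))
    ... | false = xu (trans (sym (proj₂ (hp x) ev)) e)
  atUW : f u + f w ≡ 𝟙 (A w) + (g u + g w)
  atUW rewrite gu | gw | pw | 𝟙-∧∧ (lt w u) (A u) (A w) | 𝟙-∧∧ (lt u w) (A w) (A u) | Au | ∧-identityʳ (A w)
    = trans (oneOrientation ord w u wu (𝟙 (A w))) (sym (+-identityʳ _))

pairsIn-empty : ∀ {N} (lt : Fin N → Fin N → Bool) → BoolOrder lt → (V A : Pred N) → ∀ p → MatchingOn V p →
  (∀ x → V x ≡ true → A x ≡ false) → pairsIn lt A p ≡ 0
pairsIn-empty lt ord V A p hp h = ΣF-0 _ noPairAt
  where
  noPairAt : ∀ x → 𝟙 ((lt (p ! x) x ∧ A x) ∧ A (p ! x)) ≡ 0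
  noPairAt x with V x in e
  ... | true rewrite h x e | 𝟙-∧∧ (lt (p ! x) x) false (A (p ! x)) = *-zeroʳ (𝟙 (lt (p ! x) x))
  ... | false rewrite proj₂ (hp x) e | BoolOrder.irr ord x = refl

-- Matchings of V in which u is paired with j correspond bijectively, by
-- removing and adding the pair {u, j}, to matchings of W = V ∖ u ∖ j.

module PairBijection {N : ℕ} (V : Pred N) (u j : Fin N) (u≢j : u ≢ j) (Vu : V u ≡ true) (Vj : V j ≡ true) where

  W : Pred N
  W = (V ∖ u) ∖ j

  W-t : ∀ {i} → W i ≡ true → (V i ≡ true) × (i ≢ u) × (i ≢ j)
  W-t e = let (a , b) = ∖-t {X = V ∖ u} e in proj₁ (∖-t {X = V} a) , proj₂ (∖-t {X = V} a) , b

  W-i : ∀ {i} → V i ≡ true → i ≢ u → i ≢ j → W i ≡ true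
  W-i a b c = ∖-i {X = V ∖ u} (∖-i {X = V} a b) c

  W-o : ∀ {i} → i ≢ u → i ≢ j → W i ≡ V i
  W-o b c = trans (∖-ne (V ∖ u) c) (∖-ne V b)

  W-u : W u ≡ false
  W-u rewrite ∖-eq V u = refl

  W-j : W j ≡ false
  W-j = ∖-eq (V ∖ u) j

  addPair-u : ∀ p' → addPair u j p' ! u ≡ j
  addPair-u p' = set2-u u j j u p' u≢j

  addPair-j : ∀ p' → addPair u j p' ! j ≡ u
  addPair-j p' = set2-j u j j u p'

  partner-j : ∀ p → MatchingOn V p → p ! u ≡ j → p ! j ≡ u
  partner-j p hp pu = trans (cong (p !_) (sym pu)) (proj₁ (proj₁ (hp u) Vu))

  removePair-matching : ∀ p → MatchingOn V p → p ! u ≡ j → MatchingOn W (removePair u j p)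
  removePair-matching p hp pu i = onW , offW
    where
    p₀ = removePair u j p
    onW : W i ≡ true → PairedIn W p₀ i
    onW wi with W-t wi
    ... | vi , iu , ij = inv , noFix , inW
      where
      k = p ! i
      hk = proj₁ (hp i) vi
      ku : k ≢ u
      ku e = ij (trans (sym (proj₁ hk)) (trans (cong (p !_) e) pu))
      kj : k ≢ j
      kj e = iu (trans (sym (proj₁ hk)) (trans (cong (p !_) e) (partner-j p hp pu)))
      p₀i : p₀ ! i ≡ k
      p₀i = set2-o u u j j p iu ij
      inv : p₀ ! (p₀ ! i) ≡ i
      inv rewrite p₀i = trans (set2-o u u j j p ku kj) (proj₁ hk)
      noFix : p₀ ! i ≢ i
      noFix rewrite p₀i = proj₁ (proj₂ hk)
      inW : W (p₀ ! i) ≡ true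
      inW rewrite p₀i = W-i (proj₂ (proj₂ hk)) ku kj
    offW : W i ≡ false → p₀ ! i ≡ i
    offW wi with i ≟F u | i ≟F j
    ... | yes refl | _ = set2-u u u j j p u≢j
    ... | no _ | yes refl = set2-j u u j j p
    ... | no iu | no ij = trans (set2-o u u j j p iu ij) (proj₂ (hp i) (trans (sym (W-o iu ij)) wi))

  addPair-matching : ∀ p' → MatchingOn W p' → MatchingOn V (addPair u j p')
  addPair-matching p' hp i = onV , offV
    where
    q = addPair u j p'
    onV : V i ≡ true → PairedIn V q i
    onV vi with i ≟F u | i ≟F j
    ... | yes refl | _ = trans (cong (q !_) (addPair-u p')) (addPair-j p') ,
                          (λ e → u≢j (trans (sym e) (addPair-u p'))) ,
                          subst (λ z → V z ≡ true) (sym (addPair-u p')) Vj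
    ... | no _ | yes refl = trans (cong (q !_) (addPair-j p')) (addPair-u p') ,
                             (λ e → u≢j (trans (sym (addPair-j p')) e)) ,
                             subst (λ z → V z ≡ true) (sym (addPair-j p')) Vu
    ... | no iu | no ij = inv , noFix , inV
      where
      hk = proj₁ (hp i) (W-i vi iu ij)
      wk = W-t (proj₂ (proj₂ hk))
      qi : q ! i ≡ p' ! i
      qi = set2-o u j j u p' iu ij
      inv : q ! (q ! i) ≡ i
      inv rewrite qi = trans (set2-o u j j u p' (proj₁ (proj₂ wk)) (proj₂ (proj₂ wk))) (proj₁ hk)
      noFix : q ! i ≢ i
      noFix rewrite qi = proj₁ (proj₂ hk)
      inV : V (q ! i) ≡ true
      inV rewrite qi = proj₁ wk
    offV : V i ≡ false → q ! i ≡ i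
    offV vi = trans (set2-o u j j u p' iu ij) (proj₂ (hp i) (trans (W-o iu ij) vi))
      where
      iu : i ≢ u
      iu refl = t≢f Vu vi
      ij : i ≢ j
      ij refl = t≢f Vj vi

  addPair∘removePair : ∀ p → MatchingOn V p → p ! u ≡ j → addPair u j (removePair u j p) ≡ p
  addPair∘removePair p hp pu = vec-ext pointwise
    where
    pointwise : ∀ i → addPair u j (removePair u j p) ! i ≡ p ! i
    pointwise i with i ≟F u | i ≟F j
    ... | yes refl | _ = trans (addPair-u (removePair u j p)) (sym pu)
    ... | no _ | yes refl = trans (addPair-j (removePair u j p)) (sym (partner-j p hp pu))
    ... | no iu | no ij = trans (set2-o u j j u (removePair u j p) iu ij) (set2-o u u j j p iu ij)

  removePair∘addPair : ∀ p' → MatchingOn W p' → removePair u j (addPair u j p') ≡ p'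
  removePair∘addPair p' hp = vec-ext pointwise
    where
    pointwise : ∀ i → removePair u j (addPair u j p') ! i ≡ p' ! i
    pointwise i with i ≟F u | i ≟F j
    ... | yes refl | _ = trans (set2-u u u j j (addPair u j p') u≢j) (sym (proj₂ (hp u) W-u))
    ... | no _ | yes refl = trans (set2-j u u j j (addPair u j p')) (sym (proj₂ (hp j) W-j))
    ... | no iu | no ij = trans (set2-o u u j j (addPair u j p') iu ij) (set2-o u j j u p' iu ij)

  ΣMatching-pair : (F : Endo N → ℕ) →
    ΣVec N N (λ p → 𝟙 (isMatchingOn V p ∧ eqF (p ! u) j) * F p) ≡
    ΣVec N N (λ p' → 𝟙 (isMatchingOn W p') * F (addPair u j p'))
  ΣMatching-pair F = reindex N N (λ p → isMatchingOn V p ∧ eqF (p ! u) j) (isMatchingOn W) (removePair u j) (addPair u j) F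
    (λ p e → ⇒isMatchingOn {V = W} {p = removePair u j p}
               (removePair-matching p (isMatchingOn⇒ {V = V} {p = p} (∧-l e)) (eqF-true (∧-r e))))
    (λ p e → addPair∘removePair p (isMatchingOn⇒ {V = V} {p = p} (∧-l e)) (eqF-true (∧-r e)))
    (λ p' e → ∧-i (⇒isMatchingOn {V = V} {p = addPair u j p'} (addPair-matching p' (isMatchingOn⇒ {V = W} {p = p'} e)))
                  (eqF-i (addPair-u p')))
    (λ p' e → removePair∘addPair p' (isMatchingOn⇒ {V = W} {p = p'} e))

  pairsIn-addPair : ∀ (lt : Fin N → Fin N → Bool) → BoolOrder lt → (A : Pred N) → ∀ p' → MatchingOn W p' →
    pairsIn lt A (addPair u j p') ≡ pairsIn lt A p' + 𝟙 (A u ∧ A j)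
  pairsIn-addPair lt ord A p' hp = ΣF-twoPoint f g (𝟙 (A u ∧ A j)) u≢j off atUJ
    where
    q = addPair u j p'
    f g : Fin N → ℕ
    f x = 𝟙 ((lt (q ! x) x ∧ A x) ∧ A (q ! x))
    g x = 𝟙 ((lt (p' ! x) x ∧ A x) ∧ A (p' ! x))
    gu : g u ≡ 0
    gu rewrite proj₂ (hp u) W-u | BoolOrder.irr ord u = refl
    gj : g j ≡ 0
    gj rewrite proj₂ (hp j) W-j | BoolOrder.irr ord j = refl
    off : ∀ x → x ≢ u → x ≢ j → f x ≡ g x
    off x xu xj = cong (λ k → 𝟙 ((lt k x ∧ A x) ∧ A k)) (set2-o u j j u p' xu xj)
    atUJ : f u + f j ≡ 𝟙 (A u ∧ A j) + (g u + g j)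
    atUJ rewrite addPair-u p' | addPair-j p' | gu | gj
               | 𝟙-∧∧ (lt j u) (A u) (A j) | 𝟙-∧∧ (lt u j) (A j) (A u) | ∧-comm (A j) (A u)
      = trans (oneOrientation ord j u (λ e → u≢j (sym e)) (𝟙 (A u ∧ A j))) (sym (+-identityʳ _))

ΣMatching-decompose : ∀ {N} (V : Pred N) (u : Fin N) → V u ≡ true → (F : Endo N → ℕ) →
  ΣVec N N (λ p → 𝟙 (isMatchingOn V p) * F p) ≡
  ΣF (λ j → 𝟙 ((V ∖ u) j) * ΣVec N N (λ p' → 𝟙 (isMatchingOn ((V ∖ u) ∖ j) p') * F (addPair u j p')))
ΣMatching-decompose {N} V u Vu F = begin
  ΣVec N N (λ p → 𝟙 (isMatchingOn V p) * F p)
    ≡⟨ ΣVec-cong N N byPartner ⟩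
  ΣVec N N (λ p → ΣF (λ j → M p j))
    ≡⟨ Σl-ΣF-swap (allVecs N N) M ⟩
  ΣF (λ j → ΣVec N N (λ p → M p j))
    ≡⟨ ΣF-cong partnerJ ⟩
  ΣF (λ j → 𝟙 ((V ∖ u) j) * ΣVec N N (λ p' → 𝟙 (isMatchingOn ((V ∖ u) ∖ j) p') * F (addPair u j p'))) ∎
  where
  M : Endo N → Fin N → ℕ
  M p j = 𝟙 (isMatchingOn V p ∧ eqF (p ! u) j) * F p
  byPartner : ∀ p → 𝟙 (isMatchingOn V p) * F p ≡ ΣF (M p)
  byPartner p = sym (trans (ΣF-cong (λ j → trans (𝟙-∧-* (isMatchingOn V p) (eqF (p ! u) j) (F p))
                                                  (cong (λ b → 𝟙 b * (𝟙 (isMatchingOn V p) * F p)) (eqF-sym (p ! u) j))))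
                           (ΣF-δ (p ! u) (λ _ → 𝟙 (isMatchingOn V p) * F p)))
  partnerJ : ∀ j → ΣVec N N (λ p → M p j) ≡
                   𝟙 ((V ∖ u) j) * ΣVec N N (λ p' → 𝟙 (isMatchingOn ((V ∖ u) ∖ j) p') * F (addPair u j p'))
  partnerJ j with (V ∖ u) j in e
  ... | true = trans (PairBijection.ΣMatching-pair V u j (λ q → proj₂ (∖-t {X = V} e) (sym q)) Vu (∧-l e) F)
                     (sym (+-identityʳ _))
  ... | false = Σl-0 (allVecs N N) _ noMatching
    where
    -- the partner of u lies in V ∖ u
    noMatching : ∀ p → M p j ≡ 0
    noMatching p with isMatchingOn V p ∧ eqF (p ! u) j in e2
    ... | false = refl
    ... | true = ⊥-elim (t≢f (subst (λ k → (V ∖ u) k ≡ true) (eqF-true (∧-r e2))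
                                 (∖-i {X = V} (proj₂ (proj₂ hu)) (proj₁ (proj₂ hu)))) e)
      where hu = proj₁ (isMatchingOn⇒ {V = V} {p = p} (∧-l e2) u) Vu

-- The counting numbers.  `choose` is the binomial coefficient by Pascal's
-- rule, `part a q` the number of ways to choose q disjoint pairs among a
-- points (the first point is unused, or paired with one of the others), and
-- `perf k` the number of perfect matchings of k points.

choose : ℕ → ℕ → ℕ
choose n zero = 1
choose zero (suc k) = 0
choose (suc n) (suc k) = choose n k + choose n (suc k)

part : ℕ → ℕ → ℕ
part a zero = 1
part zero (suc q) = 0
part (suc zero) (suc q) = 0
part (suc (suc a)) (suc q) = part (suc a) (suc q) + suc a * part a q

perf : ℕ → ℕ
perf zero = 1
perf (suc zero) = 0
perf (suc (suc k)) = suc k * perf k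

part-rec : ∀ a q → part (suc a) (suc q) ≡ part a (suc q) + a * part (a ∸ 1) q
part-rec zero q = refl
part-rec (suc a) q = refl

choose≡C : ∀ n k → choose n k ≡ n C k
choose≡C n zero = sym (trans (nCk≡nC[n∸k] {0} {n} z≤n) (nCn≡1 n))
choose≡C zero (suc k) = refl
choose≡C (suc n) (suc k) = trans (cong₂ _+_ (choose≡C n k) (choose≡C n (suc k))) (nCk+nC[k+1]≡[n+1]C[k+1] n k)

choose-step : ∀ L b q → choose (L + 𝟙 b) (suc q) ≡ choose L (suc q) + 𝟙 b * choose L q
choose-step L false q = trans (cong (λ z → choose z (suc q)) (+-identityʳ L)) (sym (+-identityʳ _))
choose-step L true q = begin
  choose (L + 1) (suc q)              ≡⟨ cong (λ z → choose z (suc q)) (+-comm L 1) ⟩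
  choose L q + choose L (suc q)       ≡⟨ +-comm (choose L q) (choose L (suc q)) ⟩
  choose L (suc q) + choose L q       ≡⟨ cong (choose L (suc q) +_) (+-identityʳ (choose L q)) ⟨
  choose L (suc q) + 1 * choose L q   ∎

choose-1 : ∀ m → choose m 1 ≡ m
choose-1 zero = refl
choose-1 (suc m) = cong suc (choose-1 m)

choose-absorb : ∀ n k → choose (suc n) (suc k) * suc k ≡ suc n * choose n k
choose-absorb zero zero = refl
choose-absorb zero (suc k) = refl
choose-absorb (suc n) zero = trans (*-identityʳ _) (trans (choose-1 (suc (suc n))) (sym (*-identityʳ _)))
choose-absorb (suc n) (suc k) = begin
  (c₁ + c₂) * suc (suc k)                       ≡⟨ expand c₁ c₂ k ⟩
  (c₁ * suc k + c₁) + c₂ * suc (suc k)          ≡⟨ cong₂ (λ a b → (a + c₁) + b) (choose-absorb n k) (choose-absorb n (suc k)) ⟩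
  (suc n * d₀ + (d₀ + d₁)) + suc n * d₁         ≡⟨ collect n d₀ d₁ ⟩
  suc (suc n) * (d₀ + d₁)                       ∎
  where
  c₁ = choose (suc n) (suc k)
  c₂ = choose (suc n) (suc (suc k))
  d₀ = choose n k
  d₁ = choose n (suc k)
  expand : ∀ x y k → (x + y) * suc (suc k) ≡ (x * suc k + x) + y * suc (suc k)
  expand = solve-∀
  collect : ∀ n a b → (suc n * a + (a + b)) + suc n * b ≡ suc (suc n) * (a + b)
  collect = solve-∀

part≡choose : ∀ a q → part a q ≡ choose a (2 * q) * oddDF q
part≡choose a zero = refl
part≡choose zero (suc q) = cong (λ z → choose 0 z * oddDF (suc q)) (sym (*-suc 2 q))
part≡choose (suc zero) (suc q) = cong (λ z → choose 1 z * oddDF (suc q)) (sym (*-suc 2 q))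
part≡choose (suc (suc a)) (suc q) = begin
  part (suc a) (suc q) + suc a * part a q
    ≡⟨ cong₂ (λ x y → x + suc a * y) (part≡choose (suc a) (suc q)) (part≡choose a q) ⟩
  choose (suc a) (2 * suc q) * oddDF (suc q) + suc a * (choose a k * D)
    ≡⟨ cong (_+ suc a * (choose a k * D)) (normalise (suc a)) ⟩
  choose (suc a) (suc (suc k)) * (suc k * D) + suc a * (choose a k * D)
    ≡⟨ cong (choose (suc a) (suc (suc k)) * (suc k * D) +_) absorbed ⟩
  choose (suc a) (suc (suc k)) * (suc k * D) + choose (suc a) (suc k) * suc k * D
    ≡⟨ pascal (choose (suc a) (suc k)) (choose (suc a) (suc (suc k))) k D ⟩
  choose (suc (suc a)) (suc (suc k)) * (suc k * D)
    ≡⟨ normalise (suc (suc a)) ⟨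
  choose (suc (suc a)) (2 * suc q) * oddDF (suc q) ∎
  where
  k = 2 * q
  D = oddDF q
  normalise : ∀ b → choose b (2 * suc q) * oddDF (suc q) ≡ choose b (suc (suc k)) * (suc k * D)
  normalise b = cong₂ (λ z w → choose b z * (w * D)) (*-suc 2 q) (+-comm k 1)
  absorbed : suc a * (choose a k * D) ≡ choose (suc a) (suc k) * suc k * D
  absorbed = trans (sym (*-assoc (suc a) (choose a k) D)) (cong (_* D) (sym (choose-absorb a k)))
  pascal : ∀ x₁ x₂ k d → x₂ * (suc k * d) + x₁ * suc k * d ≡ (x₁ + x₂) * (suc k * d)
  pascal = solve-∀

part≡C : ∀ a q → part a q ≡ (a C (2 * q)) * oddDF q
part≡C a q = trans (part≡choose a q) (cong (_* oddDF q) (choose≡C a (2 * q)))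

part-zero : ∀ a q → a < 2 * q → part a q ≡ 0
part-zero a q a<2q = trans (part≡C a q) (cong (_* oddDF q) (k>n⇒nCk≡0 a<2q))

perf-even : ∀ m → perf (2 * m) ≡ oddDF m
perf-even zero = refl
perf-even (suc m) rewrite *-suc 2 m | perf-even m | +-comm (2 * m) 1 = refl

-- The number of perfect matchings of a set V is perf |V|, by induction on
-- |V| (bounded by the fuel m): the empty set has only the identity, and
-- otherwise a point u has |V| - 1 possible partners j, each leaving V ∖ u ∖ j.

idEndo : ∀ {N} → Endo N
idEndo = tabulate (λ i → i)

matching-empty : ∀ {N} (V : Pred N) → (∀ x → V x ≡ false) → ∀ p → isMatchingOn V p ≡ eqV p idEndo
matching-empty V empty p = bool-iff toId fromId
  where
  idEndo-! : ∀ i → idEndo ! i ≡ i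
  idEndo-! = lookup∘tabulate (λ k → k)
  toId : isMatchingOn V p ≡ true → eqV p idEndo ≡ true
  toId e = subst (λ z → eqV p z ≡ true)
             (vec-ext {x = p} (λ i → trans (proj₂ (isMatchingOn⇒ {V = V} {p = p} e i) (empty i)) (sym (idEndo-! i))))
             (eqV-refl p)
  fromId : eqV p idEndo ≡ true → isMatchingOn V p ≡ true
  fromId e = subst (λ z → isMatchingOn V z ≡ true) (sym (eqV-true {x = p} {y = idEndo} e))
               (⇒isMatchingOn {V = V} {p = idEndo} (λ i → (λ vi → ⊥-elim (t≢f vi (empty i))) , (λ _ → idEndo-! i)))

perf-count : ∀ {N} m (V : Pred N) → size V < m → ΣVec N N (λ p → 𝟙 (isMatchingOn V p) * 1) ≡ perf (size V)
perf-count {N} (suc m) V bound with search V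
... | inj₂ empty = begin
  ΣVec N N (λ p → 𝟙 (isMatchingOn V p) * 1) ≡⟨ ΣVec-cong N N (λ p → cong (λ b → 𝟙 b * 1) (matching-empty V empty p)) ⟩
  ΣVec N N (λ p → 𝟙 (eqV p idEndo) * 1)     ≡⟨ ΣVec-δ N N idEndo (λ _ → 1) ⟩
  1                                         ≡⟨ cong perf (size-zero empty) ⟨
  perf (size V)                             ∎
... | inj₁ (u , Vu) = begin
  ΣVec N N (λ p → 𝟙 (isMatchingOn V p) * 1)
    ≡⟨ ΣMatching-decompose V u Vu (λ _ → 1) ⟩
  ΣF (λ j → 𝟙 ((V ∖ u) j) * ΣVec N N (λ p' → 𝟙 (isMatchingOn ((V ∖ u) ∖ j) p') * 1))
    ≡⟨ ΣF-cong partnerJ ⟩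
  ΣF (λ j → 𝟙 ((V ∖ u) j) * perf (size (V ∖ u) ∸ 1))
    ≡⟨ ΣF-𝟙-const (V ∖ u) (perf (size (V ∖ u) ∸ 1)) ⟩
  size (V ∖ u) * perf (size (V ∖ u) ∸ 1)
    ≡⟨ perf-unfold (size (V ∖ u)) ⟩
  perf (suc (size (V ∖ u)))
    ≡⟨ cong perf (size-remove V u Vu) ⟨
  perf (size V) ∎
  where
  perf-unfold : ∀ k → k * perf (k ∸ 1) ≡ perf (suc k)
  perf-unfold zero = refl
  perf-unfold (suc k) = refl
  partnerJ : ∀ j → 𝟙 ((V ∖ u) j) * ΣVec N N (λ p' → 𝟙 (isMatchingOn ((V ∖ u) ∖ j) p') * 1) ≡
                   𝟙 ((V ∖ u) j) * perf (size (V ∖ u) ∸ 1)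
  partnerJ j with (V ∖ u) j in e
  ... | false = refl
  ... | true = cong (1 *_) (trans (perf-count m ((V ∖ u) ∖ j) smaller) (cong perf (cong (_∸ 1) (sym sizeVu))))
    where
    sizeVu : size (V ∖ u) ≡ suc (size ((V ∖ u) ∖ j))
    sizeVu = size-remove (V ∖ u) j e
    smaller : size ((V ∖ u) ∖ j) < m
    smaller = ≤-trans (n≤1+n _) (≤-trans (≤-reflexive (sym (trans (size-remove V u Vu) (cong suc sizeVu)))) (≤-pred bound))

Disjoint : ∀ {N} → Pred N → Pred N → Pred N → Set
Disjoint V A B = ∀ x → V x ≡ true → A x ≡ true → B x ≡ false

pairSum : ∀ {N} → (Fin N → Fin N → Bool) → (Fin N → Fin N → Bool) → Pred N → Pred N → Pred N → ℕ → ℕ → ℕ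
pairSum {N} lt₁ lt₂ V A B q r =
  ΣVec N N (λ p → 𝟙 (isMatchingOn V p) * (choose (pairsIn lt₁ A p) q * choose (pairsIn lt₂ B p) r))

pairSumClosed : ∀ {N} → Pred N → Pred N → Pred N → ℕ → ℕ → ℕ
pairSumClosed V A B q r = part (size (A ∩ V)) q * part (size (B ∩ V)) r * perf (size V ∸ 2 * q ∸ 2 * r)

∩-∖ : ∀ {N} (A V : Pred N) u x → ((A ∩ V) ∖ u) x ≡ ((A ∖ u) ∩ V) x
∩-∖ A V u x = begin
  (A x ∧ V x) ∧ not (eqF x u)   ≡⟨ ∧-assoc (A x) (V x) _ ⟩
  A x ∧ (V x ∧ not (eqF x u))   ≡⟨ cong (A x ∧_) (∧-comm (V x) _) ⟩
  A x ∧ (not (eqF x u) ∧ V x)   ≡⟨ ∧-assoc (A x) _ (V x) ⟨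
  (A x ∧ not (eqF x u)) ∧ V x   ∎

∖-∩-swap : ∀ {N} (A V : Pred N) u x → ((A ∖ u) ∩ V) x ≡ ((V ∖ u) ∩ A) x
∖-∩-swap A V u x = trans (sym (∩-∖ A V u x)) (trans (cong (_∧ not (eqF x u)) (∧-comm (A x) (V x))) (∩-∖ V A u x))

∩-∖∖ : ∀ {N} (A V : Pred N) u j x → (((A ∖ u) ∩ V) ∖ j) x ≡ ((A ∖ u) ∩ ((V ∖ u) ∖ j)) x
∩-∖∖ A V u j x = truthTable (A x) (eqF x u) (V x) (eqF x j)
  where truthTable : ∀ a e v f → ((a ∧ not e) ∧ v) ∧ not f ≡ (a ∧ not e) ∧ ((v ∧ not e) ∧ not f)
        truthTable false e v f = refl
        truthTable true true v f = refl
        truthTable true false true f = refl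
        truthTable true false false f = refl

-- Pascal's rule
-- splits the matchings according to whether the pair of u lies inside A;
-- those with u paired to j ∈ A are counted on V ∖ u ∖ j.
module KeyStep {N : ℕ} (lt₁ lt₂ : Fin N → Fin N → Bool) (ord₁ : BoolOrder lt₁) (ord₂ : BoolOrder lt₂)
  (V A B : Pred N) (u : Fin N) (Au : A u ≡ true) (Vu : V u ≡ true) (disj : Disjoint V A B) where

  a₀ : ℕ
  a₀ = size ((A ∖ u) ∩ V)

  sizeA : size (A ∩ V) ≡ suc a₀
  sizeA = trans (size-remove (A ∩ V) u (∧-i Au Vu)) (cong suc (size-cong (∩-∖ A V u)))

  Bu : B u ≡ false
  Bu = disj u Vu Au

  partnerInA : Pred N
  partnerInA = (V ∖ u) ∩ A

  module Partner (j : Fin N) (pj : partnerInA j ≡ true) where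
    Vj : V j ≡ true
    Vj = proj₁ (∖-t {X = V} (∧-l pj))
    Aj : A j ≡ true
    Aj = ∧-r {a = (V ∖ u) j} pj
    u≢j : u ≢ j
    u≢j e = proj₂ (∖-t {X = V} (∧-l pj)) (sym e)
    open PairBijection V u j u≢j Vu Vj public

    sizeV : size V ≡ suc (suc (size W))
    sizeV = trans (size-remove V u Vu) (cong suc (size-remove (V ∖ u) j (∧-l pj)))
    sizeA∖u : a₀ ≡ suc (size ((A ∖ u) ∩ W))
    sizeA∖u = trans (size-remove ((A ∖ u) ∩ V) j (∧-i (∖-i {X = A} Aj (λ e → u≢j (sym e))) Vj))
                    (cong suc (size-cong (∩-∖∖ A V u j)))
    sizeB : size (B ∩ W) ≡ size (B ∩ V)
    sizeB = size-cong sameB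
      where
      sameB : ∀ x → B x ∧ W x ≡ B x ∧ V x
      sameB x with x ≟F u | x ≟F j
      ... | yes refl | _ rewrite Bu = refl
      ... | no _ | yes refl rewrite disj j Vj Aj = refl
      ... | no xu | no xj = cong (B x ∧_) (W-o xu xj)

  module _ (q r : ℕ) where

    R : Endo N → ℕ
    R p = choose (pairsIn lt₂ B p) r

    pairedInA : Endo N → ℕ
    pairedInA p = 𝟙 (A (p ! u)) * (choose (pairsIn lt₁ (A ∖ u) p) q * R p)

    pascalSplit : pairSum lt₁ lt₂ V A B (suc q) r ≡
      pairSum lt₁ lt₂ V (A ∖ u) B (suc q) r + ΣVec N N (λ p → 𝟙 (isMatchingOn V p) * pairedInA p)
    pascalSplit = trans (ΣVec-cong N N split) (Σl-+ (allVecs N N) _ _)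
      where
      split : ∀ p → 𝟙 (isMatchingOn V p) * (choose (pairsIn lt₁ A p) (suc q) * R p) ≡
                    𝟙 (isMatchingOn V p) * (choose (pairsIn lt₁ (A ∖ u) p) (suc q) * R p) + 𝟙 (isMatchingOn V p) * pairedInA p
      split p with isMatchingOn V p in e
      ... | false = refl
      ... | true rewrite pairsIn-remove lt₁ ord₁ V A u p (isMatchingOn⇒ {V = V} {p = p} e) Vu Au
                       | choose-step (pairsIn lt₁ (A ∖ u) p) (A (p ! u)) q
          = distrib (choose (pairsIn lt₁ (A ∖ u) p) (suc q)) (𝟙 (A (p ! u))) (choose (pairsIn lt₁ (A ∖ u) p) q) (R p)
        where distrib : ∀ x b y z → 1 * ((x + b * y) * z) ≡ 1 * (x * z) + 1 * (b * (y * z))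
              distrib = solve-∀

    -- the value of the second sum for each partner j ∈ A of u
    E : ℕ
    E = part (a₀ ∸ 1) q * part (size (B ∩ V)) r * perf (size V ∸ 2 ∸ 2 * q ∸ 2 * r)

    -- For the partner j of u: nothing if j ∉ A; if j ∈ A, the pair {u, j} lies
    -- neither in A ∖ u nor in B, so the weight is that of the matching of
    -- V ∖ u ∖ j, and the induction hypothesis evaluates the sum.
    partnerTerm : (∀ j → partnerInA j ≡ true →
                     pairSum lt₁ lt₂ ((V ∖ u) ∖ j) (A ∖ u) B q r ≡ pairSumClosed ((V ∖ u) ∖ j) (A ∖ u) B q r) →
      ∀ j → 𝟙 ((V ∖ u) j) * ΣVec N N (λ p' → 𝟙 (isMatchingOn ((V ∖ u) ∖ j) p') * pairedInA (addPair u j p'))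
            ≡ 𝟙 (partnerInA j) * E
    partnerTerm ih j with (V ∖ u) j in e
    ... | false = refl
    ... | true with A j in ea
    ...   | false = cong (1 *_) (Σl-0 (allVecs N N) _ notInA)
      where
      notInA : ∀ p' → 𝟙 (isMatchingOn ((V ∖ u) ∖ j) p') * pairedInA (addPair u j p') ≡ 0
      notInA p' rewrite PairBijection.addPair-u V u j (λ q → proj₂ (∖-t {X = V} e) (sym q)) Vu (proj₁ (∖-t {X = V} e)) p' | ea
        = *-zeroʳ (𝟙 (isMatchingOn ((V ∖ u) ∖ j) p'))
    ...   | true = cong (1 *_) (begin
      ΣVec N N (λ p' → 𝟙 (isMatchingOn W p') * pairedInA (addPair u j p'))
        ≡⟨ ΣVec-cong N N sameWeight ⟩
      pairSum lt₁ lt₂ W (A ∖ u) B q r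
        ≡⟨ ih j pj ⟩
      pairSumClosed W (A ∖ u) B q r
        ≡⟨ cong₂ (λ a c → part a q * part (size (B ∩ W)) r * perf (c ∸ 2 * q ∸ 2 * r))
                 (cong (_∸ 1) (sym sizeA∖u)) (cong (_∸ 2) (sym sizeV)) ⟩
      part (a₀ ∸ 1) q * part (size (B ∩ W)) r * perf (size V ∸ 2 ∸ 2 * q ∸ 2 * r)
        ≡⟨ cong (λ b → part (a₀ ∸ 1) q * part b r * perf (size V ∸ 2 ∸ 2 * q ∸ 2 * r)) sizeB ⟩
      E ∎)
      where
      pj : partnerInA j ≡ true
      pj = ∧-i e ea
      open Partner j pj
      sameWeight : ∀ p' → 𝟙 (isMatchingOn W p') * pairedInA (addPair u j p') ≡
                          𝟙 (isMatchingOn W p') * (choose (pairsIn lt₁ (A ∖ u) p') q * choose (pairsIn lt₂ B p') r)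
      sameWeight p' with isMatchingOn W p' in em
      ... | false = refl
      ... | true rewrite addPair-u p' | ea
                 | pairsIn-addPair lt₁ ord₁ (A ∖ u) p' (isMatchingOn⇒ {V = W} {p = p'} em)
                 | pairsIn-addPair lt₂ ord₂ B p' (isMatchingOn⇒ {V = W} {p = p'} em)
                 | ∖-eq A u | Bu
                 | +-identityʳ (pairsIn lt₁ (A ∖ u) p') | +-identityʳ (pairsIn lt₂ B p') = +-identityʳ _

    partnerSum : (∀ j → partnerInA j ≡ true →
                   pairSum lt₁ lt₂ ((V ∖ u) ∖ j) (A ∖ u) B q r ≡ pairSumClosed ((V ∖ u) ∖ j) (A ∖ u) B q r) →
      ΣVec N N (λ p → 𝟙 (isMatchingOn V p) * pairedInA p) ≡ a₀ * E
    partnerSum ih = begin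
      ΣVec N N (λ p → 𝟙 (isMatchingOn V p) * pairedInA p)
        ≡⟨ ΣMatching-decompose V u Vu pairedInA ⟩
      ΣF (λ j → 𝟙 ((V ∖ u) j) * ΣVec N N (λ p' → 𝟙 (isMatchingOn ((V ∖ u) ∖ j) p') * pairedInA (addPair u j p')))
        ≡⟨ ΣF-cong (partnerTerm ih) ⟩
      ΣF (λ j → 𝟙 (partnerInA j) * E)
        ≡⟨ ΣF-𝟙-const partnerInA E ⟩
      size partnerInA * E
        ≡⟨ cong (_* E) (size-cong (λ x → sym (∖-∩-swap A V u x))) ⟩
      a₀ * E ∎

    sizeV-2 : size V ∸ 2 ∸ 2 * q ∸ 2 * r ≡ size V ∸ 2 * suc q ∸ 2 * r
    sizeV-2 = cong (_∸ 2 * r) (trans (∸-+-assoc (size V) 2 (2 * q)) (cong (size V ∸_) (sym (*-suc 2 q))))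

    closedRecurrence : pairSumClosed V (A ∖ u) B (suc q) r + a₀ * E ≡ pairSumClosed V A B (suc q) r
    closedRecurrence rewrite sizeA | part-rec a₀ q | sizeV-2 =
      sym (collect (part a₀ (suc q)) a₀ (part (a₀ ∸ 1) q) (part (size (B ∩ V)) r) (perf (size V ∸ 2 * suc q ∸ 2 * r)))
      where
      collect : ∀ x a y b d → (x + a * y) * b * d ≡ x * b * d + a * (y * b * d)
      collect = solve-∀

    step : pairSum lt₁ lt₂ V (A ∖ u) B (suc q) r ≡ pairSumClosed V (A ∖ u) B (suc q) r →
      (∀ j → partnerInA j ≡ true →
         pairSum lt₁ lt₂ ((V ∖ u) ∖ j) (A ∖ u) B q r ≡ pairSumClosed ((V ∖ u) ∖ j) (A ∖ u) B q r) →
      pairSum lt₁ lt₂ V A B (suc q) r ≡ pairSumClosed V A B (suc q) r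
    step ihA ihPartner = begin
      pairSum lt₁ lt₂ V A B (suc q) r
        ≡⟨ pascalSplit ⟩
      pairSum lt₁ lt₂ V (A ∖ u) B (suc q) r + ΣVec N N (λ p → 𝟙 (isMatchingOn V p) * pairedInA p)
        ≡⟨ cong₂ _+_ ihA (partnerSum ihPartner) ⟩
      pairSumClosed V (A ∖ u) B (suc q) r + a₀ * E
        ≡⟨ closedRecurrence ⟩
      pairSumClosed V A B (suc q) r ∎

-- The key lemma, by induction on |A ∩ V| + |B ∩ V| (bounded by the fuel m):
-- for q = r = 0 it counts perfect matchings, the case r > 0 = q follows by
-- exchanging A and B, and for q > 0 either A ∩ V is empty (both sides vanish)
-- or a point u ∈ A ∩ V gives the recursion of `KeyStep`.

measure : ∀ {N} → Pred N → Pred N → Pred N → ℕ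
measure V A B = size (A ∩ V) + size (B ∩ V)

PairSumClosedBelow : ℕ → Set
PairSumClosedBelow m = ∀ {N} (lt₁ lt₂ : Fin N → Fin N → Bool) → BoolOrder lt₁ → BoolOrder lt₂ →
  (V A B : Pred N) (q r : ℕ) → measure V A B < m → Disjoint V A B →
  pairSum lt₁ lt₂ V A B q r ≡ pairSumClosed V A B q r

pairSum-closed-suc : ∀ m → PairSumClosedBelow m → ∀ {N} (lt₁ lt₂ : Fin N → Fin N → Bool) →
  BoolOrder lt₁ → BoolOrder lt₂ → (V A B : Pred N) (q r : ℕ) → measure V A B < suc m → Disjoint V A B →
  pairSum lt₁ lt₂ V A B (suc q) r ≡ pairSumClosed V A B (suc q) r
pairSum-closed-suc m ih {N} lt₁ lt₂ ord₁ ord₂ V A B q r bound disj with search (A ∩ V)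
... | inj₂ noA = trans (Σl-0 (allVecs N N) _ noPairs) (sym closedZero)
  where
  A-outside : ∀ x → V x ≡ true → A x ≡ false
  A-outside x vx with A x in ea
  ... | false = refl
  ... | true = ⊥-elim (t≢f (∧-i ea vx) (noA x))
  noPairs : ∀ p → 𝟙 (isMatchingOn V p) * (choose (pairsIn lt₁ A p) (suc q) * choose (pairsIn lt₂ B p) r) ≡ 0
  noPairs p with isMatchingOn V p in e
  ... | false = refl
  ... | true rewrite pairsIn-empty lt₁ ord₁ V A p (isMatchingOn⇒ {V = V} {p = p} e) A-outside = refl
  closedZero : pairSumClosed V A B (suc q) r ≡ 0
  closedZero rewrite size-zero noA = refl
... | inj₁ (u , e) = step q r ihA ihPartner
  where
  open KeyStep lt₁ lt₂ ord₁ ord₂ V A B u (∧-l e) (∧-r e) disj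
  b = size (B ∩ V)
  boundA : measure V (A ∖ u) B < m
  boundA = ≤-pred (subst (_< suc m) (cong (_+ b) sizeA) bound)
  ihA = ih lt₁ lt₂ ord₁ ord₂ V (A ∖ u) B (suc q) r boundA (λ x vx ax → disj x vx (∧-l ax))
  ihPartner : ∀ j → partnerInA j ≡ true →
    pairSum lt₁ lt₂ ((V ∖ u) ∖ j) (A ∖ u) B q r ≡ pairSumClosed ((V ∖ u) ∖ j) (A ∖ u) B q r
  ihPartner j pj = ih lt₁ lt₂ ord₁ ord₂ W (A ∖ u) B q r boundW (λ x wx ax → disj x (∧-l (∧-l wx)) (∧-l ax))
    where
    open Partner j pj
    boundW : measure W (A ∖ u) B < m
    boundW = ≤-trans (n≤1+n _) (≤-pred (subst (_< suc m) (cong₂ _+_ (trans sizeA (cong suc sizeA∖u)) (sym sizeB)) bound))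

pairSum-closed : ∀ m → PairSumClosedBelow m
pairSum-closed zero lt₁ lt₂ ord₁ ord₂ V A B q r () disj
pairSum-closed (suc m) lt₁ lt₂ ord₁ ord₂ V A B zero zero bound disj =
  trans (perf-count (suc (size V)) V ≤-refl) (sym (+-identityʳ _))
pairSum-closed (suc m) lt₁ lt₂ ord₁ ord₂ V A B (suc q) r bound disj =
  pairSum-closed-suc m (pairSum-closed m) lt₁ lt₂ ord₁ ord₂ V A B q r bound disj
pairSum-closed (suc m) {N} lt₁ lt₂ ord₁ ord₂ V A B zero (suc r) bound disj = begin
  pairSum lt₁ lt₂ V A B 0 (suc r)
    ≡⟨ ΣVec-cong N N (λ p → cong (𝟙 (isMatchingOn V p) *_) (*-comm 1 (choose (pairsIn lt₂ B p) (suc r)))) ⟩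
  pairSum lt₂ lt₁ V B A (suc r) 0
    ≡⟨ pairSum-closed-suc m (pairSum-closed m) lt₂ lt₁ ord₂ ord₁ V B A r 0 boundBA disjBA ⟩
  pairSumClosed V B A (suc r) 0
    ≡⟨ cong (_* perf (size V ∸ 2 * suc r)) (*-comm (part (size (B ∩ V)) (suc r)) 1) ⟩
  pairSumClosed V A B 0 (suc r) ∎
  where
  boundBA : measure V B A < suc m
  boundBA = subst (_< suc m) (+-comm (size (A ∩ V)) (size (B ∩ V))) bound
  disjBA : Disjoint V B A
  disjBA x vx bx with A x in ea
  ... | false = refl
  ... | true = ⊥-elim (t≢f bx (disj x vx ea))

-- For fixed g < h, the configurations with
-- given pair {g, h} are the matchings of W = all ∖ g ∖ h, so the key lemma
-- evaluates their contribution.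

ltL ltR : ∀ {N} → Fin N → Fin N → Bool
ltL x y = toℕ x <ᵇ toℕ y
ltR x y = toℕ y <ᵇ toℕ x

<ᵇ-irrefl : ∀ m → (m <ᵇ m) ≡ false
<ᵇ-irrefl zero = refl
<ᵇ-irrefl (suc m) = <ᵇ-irrefl m

<ᵇ-trichotomy : ∀ m n → m ≢ n → 𝟙 (m <ᵇ n) + 𝟙 (n <ᵇ m) ≡ 1
<ᵇ-trichotomy zero zero ne = ⊥-elim (ne refl)
<ᵇ-trichotomy zero (suc n) ne = refl
<ᵇ-trichotomy (suc m) zero ne = refl
<ᵇ-trichotomy (suc m) (suc n) ne = <ᵇ-trichotomy m n (λ e → ne (cong suc e))

ordL : ∀ {N} → BoolOrder (ltL {N})
ordL = record { irr = λ x → <ᵇ-irrefl (toℕ x)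
              ; tot = λ x y ne → <ᵇ-trichotomy (toℕ x) (toℕ y) (λ e → ne (toℕ-injective e)) }

ordR : ∀ {N} → BoolOrder (ltR {N})
ordR = record { irr = λ x → <ᵇ-irrefl (toℕ x)
              ; tot = λ x y ne → <ᵇ-trichotomy (toℕ y) (toℕ x) (λ e → ne (sym (toℕ-injective e))) }

full : ∀ {N} → Pred N
full _ = true

leftOf rightOf : ∀ {N} → Fin N → Pred N
leftOf g x = toℕ x <ᵇ toℕ g
rightOf h x = toℕ h <ᵇ toℕ x

Σ<-one : ∀ N → Σ< N (λ _ → 1) ≡ N
Σ<-one zero = refl
Σ<-one (suc N) = cong suc (Σ<-one N)

Σ<-below : ∀ N k → Σ< N (λ i → 𝟙 (i <ᵇ k)) ≡ N ⊓ k
Σ<-below zero k = refl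
Σ<-below (suc N) zero = Σ<-0 N
  where Σ<-0 : ∀ N → Σ< N (λ i → 𝟙 (suc i <ᵇ 0)) ≡ 0
        Σ<-0 zero = refl
        Σ<-0 (suc N) = Σ<-0 N
Σ<-below (suc N) (suc k) = cong suc (Σ<-below N k)

Σ<-above : ∀ N k → Σ< N (λ i → 𝟙 (k <ᵇ i)) ≡ N ∸ suc k
Σ<-above zero k = refl
Σ<-above (suc N) zero = Σ<-one N
Σ<-above (suc N) (suc k) = Σ<-above N k

size-full : ∀ N → size (full {N}) ≡ N
size-full N = trans (ΣF-toℕ {N} (λ _ → 1)) (Σ<-one N)

size-leftOf : ∀ {N} (g : Fin N) → size (leftOf g) ≡ toℕ g
size-leftOf {N} g = trans (ΣF-toℕ {N} (λ i → 𝟙 (i <ᵇ toℕ g))) (trans (Σ<-below N (toℕ g)) (m≥n⇒m⊓n≡n (<⇒≤ (toℕ<n g))))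

size-rightOf : ∀ {N} (h : Fin N) → size (rightOf h) ≡ N ∸ suc (toℕ h)
size-rightOf {N} h = trans (ΣF-toℕ {N} (λ i → 𝟙 (toℕ h <ᵇ i))) (Σ<-above N (toℕ h))

countB-Σ : ∀ {A : Set} (f : A → Bool) xs → countB f xs ≡ Σl xs (λ x → 𝟙 (f x))
countB-Σ f [] = refl
countB-Σ f (x ∷ xs) with f x
... | true = cong suc (countB-Σ f xs)
... | false = countB-Σ f xs

allB-cong : ∀ {A : Set} (f g : A → Bool) xs → (∀ x → f x ≡ g x) → allB f xs ≡ allB g xs
allB-cong f g [] h = refl
allB-cong f g (x ∷ xs) h = cong₂ _∧_ (h x) (allB-cong f g xs h)

isMatching-full : ∀ {N} (p : Endo N) → isMatching p ≡ isMatchingOn full p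
isMatching-full {N} p = allB-cong _ _ (allFinL N) (λ i → sym (∧-identityʳ _))

pairsIn-restrict : ∀ {N} (lt : Fin N → Fin N → Bool) (S : Pred N) (p' q : Endo N) →
  (∀ x → S x ≡ true → q ! x ≡ p' ! x) → (∀ x y → S x ≡ true → lt y x ≡ true → S y ≡ true) →
  ΣF (λ x → 𝟙 (lt (q ! x) x ∧ S x)) ≡ pairsIn lt S p'
pairsIn-restrict lt S p' q agree closed = ΣF-cong pointwise
  where
  pointwise : ∀ x → 𝟙 (lt (q ! x) x ∧ S x) ≡ 𝟙 ((lt (p' ! x) x ∧ S x) ∧ S (p' ! x))
  pointwise x with S x in es
  ... | false rewrite ∧-zeroʳ (lt (q ! x) x) | ∧-zeroʳ (lt (p' ! x) x) = refl
  ... | true rewrite agree x es | ∧-identityʳ (lt (p' ! x) x) with lt (p' ! x) x in el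
  ...   | false = refl
  ...   | true rewrite closed x (p' ! x) es el = refl

configurationSum : ℕ → ℕ → ℕ → ℕ
configurationSum N q r =
  sum (map (λ p → if isMatching p
                  then sum (map (λ g → if toℕ g <ᵇ toℕ (lookup p g)
                                       then (leftCount p g C q) * (rightCount p g C r)
                                       else 0)
                                (allFinL N))
                  else 0)
           (allVecs N N))

module Configurations (N q r : ℕ) where

  -- the contribution of a given pair {g < h}
  gapTerm : Fin N → Fin N → ℕ
  gapTerm g h = part (toℕ g) q * part (N ∸ suc (toℕ h)) r * perf (N ∸ 2 ∸ 2 * q ∸ 2 * r)

  weight : Endo N → Fin N → ℕ
  weight p g = (leftCount p g C q) * (rightCount p g C r)

  term : Endo N → Fin N → Fin N → ℕ
  term p g h = 𝟙 (isMatchingOn full p ∧ eqF (p ! g) h) * (𝟙 (ltL g h) * weight p g)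

  byGivenPair : ∀ p → (if isMatching p then Σl (allFinL N) (λ g → if toℕ g <ᵇ toℕ (p ! g) then weight p g else 0) else 0)
                      ≡ ΣF (λ g → ΣF (λ h → term p g h))
  byGivenPair p = begin
    (if isMatching p then Σl (allFinL N) (λ g → if ltL g (p ! g) then weight p g else 0) else 0)
      ≡⟨ if-𝟙 (isMatching p) _ ⟩
    𝟙 (isMatching p) * Σl (allFinL N) (λ g → if ltL g (p ! g) then weight p g else 0)
      ≡⟨ cong₂ (λ b x → 𝟙 b * x) (isMatching-full p)
               (trans (Σl-allFin (λ g → if ltL g (p ! g) then weight p g else 0))
                      (ΣF-cong (λ g → if-𝟙 (ltL g (p ! g)) (weight p g)))) ⟩
    𝟙 M * ΣF (λ g → 𝟙 (ltL g (p ! g)) * weight p g)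
      ≡⟨ ΣF-* (𝟙 M) (λ g → 𝟙 (ltL g (p ! g)) * weight p g) ⟨
    ΣF (λ g → 𝟙 M * (𝟙 (ltL g (p ! g)) * weight p g))
      ≡⟨ ΣF-cong (λ g → sym (partnerDelta g)) ⟩
    ΣF (λ g → ΣF (λ h → term p g h)) ∎
    where
    M = isMatchingOn full p
    partnerDelta : ∀ g → ΣF (λ h → term p g h) ≡ 𝟙 M * (𝟙 (ltL g (p ! g)) * weight p g)
    partnerDelta g = trans (ΣF-cong (λ h → trans (𝟙-∧-* M (eqF (p ! g) h) _)
                                               (cong (λ b → 𝟙 b * (𝟙 M * (𝟙 (ltL g h) * weight p g))) (eqF-sym (p ! g) h))))
                           (ΣF-δ (p ! g) (λ h → 𝟙 M * (𝟙 (ltL g h) * weight p g)))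

  module GivenPair (g h : Fin N) (g<h : toℕ g < toℕ h) where
    g≢h : g ≢ h
    g≢h refl = <-irrefl refl g<h
    open PairBijection full g h g≢h refl refl public

    leftOf-inside : ∀ x → leftOf g x ≡ true → (x ≢ g) × (x ≢ h)
    leftOf-inside x lx = (λ { refl → <-irrefl refl x<g }) , (λ { refl → <-irrefl refl (<-trans x<g g<h) })
      where x<g = <ᵇ-true⇒< (toℕ x) (toℕ g) lx

    rightOf-inside : ∀ x → rightOf h x ≡ true → (x ≢ g) × (x ≢ h)
    rightOf-inside x rx = (λ { refl → <-irrefl refl (<-trans h<x g<h) }) , (λ { refl → <-irrefl refl h<x })
      where h<x = <ᵇ-true⇒< (toℕ h) (toℕ x) rx

    disjoint : Disjoint W (leftOf g) (rightOf h)
    disjoint x _ lx with rightOf h x in rx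
    ... | false = refl
    ... | true = ⊥-elim (<-irrefl refl (<-trans (<ᵇ-true⇒< (toℕ x) (toℕ g) lx) (<-trans g<h (<ᵇ-true⇒< (toℕ h) (toℕ x) rx))))

    leftCount-addPair : ∀ p' → leftCount (addPair g h p') g ≡ pairsIn ltL (leftOf g) p'
    leftCount-addPair p' = trans (countB-Σ _ (allFinL N)) (trans (Σl-allFin (λ x → 𝟙 (ltL (addPair g h p' ! x) x ∧ leftOf g x)))
      (pairsIn-restrict ltL (leftOf g) p' (addPair g h p')
        (λ x lx → set2-o g h h g p' (proj₁ (leftOf-inside x lx)) (proj₂ (leftOf-inside x lx)))
        (λ x y lx yx → <⇒<ᵇ-true (<-trans (<ᵇ-true⇒< (toℕ y) (toℕ x) yx) (<ᵇ-true⇒< (toℕ x) (toℕ g) lx)))))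

    rightCount-addPair : ∀ p' → rightCount (addPair g h p') g ≡ pairsIn ltR (rightOf h) p'
    rightCount-addPair p' rewrite addPair-u p' =
      trans (countB-Σ _ (allFinL N)) (trans (Σl-allFin (λ x → 𝟙 (ltR (addPair g h p' ! x) x ∧ rightOf h x)))
      (pairsIn-restrict ltR (rightOf h) p' (addPair g h p')
        (λ x rx → set2-o g h h g p' (proj₁ (rightOf-inside x rx)) (proj₂ (rightOf-inside x rx)))
        (λ x y rx xy → <⇒<ᵇ-true (<-trans (<ᵇ-true⇒< (toℕ h) (toℕ x) rx) (<ᵇ-true⇒< (toℕ x) (toℕ y) xy)))))

    size-W : size W ≡ N ∸ 2
    size-W = cong (_∸ 2) (begin
      suc (suc (size W))  ≡⟨ cong suc (size-remove (full ∖ g) h (∖-i {X = full} refl (λ e → g≢h (sym e)))) ⟨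
      suc (size (full ∖ g)) ≡⟨ size-remove full g refl ⟨
      size (full {N})     ≡⟨ size-full N ⟩
      N                   ∎)

    inside : ∀ (S : Pred N) → (∀ x → S x ≡ true → (x ≢ g) × (x ≢ h)) → size (S ∩ W) ≡ size S
    inside S sub = size-cong pointwise
      where
      pointwise : ∀ x → S x ∧ W x ≡ S x
      pointwise x with S x in sx
      ... | false = refl
      ... | true = W-i refl (proj₁ (sub x sx)) (proj₂ (sub x sx))

    givenPairSum : ΣVec N N (λ p → 𝟙 (isMatchingOn full p ∧ eqF (p ! g) h) * (1 * weight p g)) ≡ gapTerm g h
    givenPairSum = begin
      ΣVec N N (λ p → 𝟙 (isMatchingOn full p ∧ eqF (p ! g) h) * (1 * weight p g))
        ≡⟨ ΣMatching-pair (λ p → 1 * weight p g) ⟩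
      ΣVec N N (λ p' → 𝟙 (isMatchingOn W p') * (1 * weight (addPair g h p') g))
        ≡⟨ ΣVec-cong N N sameWeight ⟩
      pairSum ltL ltR W (leftOf g) (rightOf h) q r
        ≡⟨ pairSum-closed _ ltL ltR ordL ordR W (leftOf g) (rightOf h) q r ≤-refl disjoint ⟩
      pairSumClosed W (leftOf g) (rightOf h) q r
        ≡⟨ cong₂ (λ a b → a * b * perf (size W ∸ 2 * q ∸ 2 * r))
                 (cong (λ s → part s q) (trans (inside (leftOf g) leftOf-inside) (size-leftOf g)))
                 (cong (λ s → part s r) (trans (inside (rightOf h) rightOf-inside) (size-rightOf h))) ⟩
      part (toℕ g) q * part (N ∸ suc (toℕ h)) r * perf (size W ∸ 2 * q ∸ 2 * r)
        ≡⟨ cong (λ s → part (toℕ g) q * part (N ∸ suc (toℕ h)) r * perf (s ∸ 2 * q ∸ 2 * r)) size-W ⟩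
      gapTerm g h ∎
      where
      sameWeight : ∀ p' → 𝟙 (isMatchingOn W p') * (1 * weight (addPair g h p') g) ≡
                          𝟙 (isMatchingOn W p') * (choose (pairsIn ltL (leftOf g) p') q * choose (pairsIn ltR (rightOf h) p') r)
      sameWeight p' = cong (𝟙 (isMatchingOn W p') *_) (trans (+-identityʳ _)
        (sym (cong₂ _*_ (trans (choose≡C _ q) (cong (_C q) (sym (leftCount-addPair p'))))
                        (trans (choose≡C _ r) (cong (_C r) (sym (rightCount-addPair p')))))))

  givenPair : ∀ g h → ΣVec N N (λ p → term p g h) ≡ 𝟙 (ltL g h) * gapTerm g h
  givenPair g h with ltL g h in e
  ... | false = Σl-0 (allVecs N N) _ (λ p → *-zeroʳ (𝟙 (isMatchingOn full p ∧ eqF (p ! g) h)))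
  ... | true = trans (GivenPair.givenPairSum g h (<ᵇ-true⇒< (toℕ g) (toℕ h) e)) (sym (+-identityʳ _))

  configurationSum-gaps : configurationSum N q r ≡ ΣF (λ g → ΣF (λ h → 𝟙 (ltL g h) * gapTerm g h))
  configurationSum-gaps = begin
    configurationSum N q r
      ≡⟨ Σl-cong (allVecs N N) byGivenPair ⟩
    ΣVec N N (λ p → ΣF (λ g → ΣF (λ h → term p g h)))
      ≡⟨ Σl-ΣF-swap (allVecs N N) (λ p g → ΣF (λ h → term p g h)) ⟩
    ΣF (λ g → ΣVec N N (λ p → ΣF (λ h → term p g h)))
      ≡⟨ ΣF-cong (λ g → trans (Σl-ΣF-swap (allVecs N N) (λ p h → term p g h)) (ΣF-cong (givenPair g))) ⟩
    ΣF (λ g → ΣF (λ h → 𝟙 (ltL g h) * gapTerm g h)) ∎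

Σ<-cong< : ∀ m {f g : ℕ → ℕ} → (∀ i → i < m → f i ≡ g i) → Σ< m f ≡ Σ< m g
Σ<-cong< zero h = refl
Σ<-cong< (suc m) h = cong₂ _+_ (h 0 z<s) (Σ<-cong< m (λ i lt → h (suc i) (s<s lt)))

Σ<-cong : ∀ m {f g : ℕ → ℕ} → (∀ i → f i ≡ g i) → Σ< m f ≡ Σ< m g
Σ<-cong m h = Σ<-cong< m (λ i _ → h i)

Σ<-zero : ∀ m (f : ℕ → ℕ) → (∀ i → i < m → f i ≡ 0) → Σ< m f ≡ 0
Σ<-zero zero f h = refl
Σ<-zero (suc m) f h = cong₂ _+_ (h 0 z<s) (Σ<-zero m (λ i → f (suc i)) (λ i lt → h (suc i) (s<s lt)))

Σ<-split : ∀ a L (f : ℕ → ℕ) → Σ< (a + L) f ≡ Σ< a f + Σ< L (λ i → f (a + i))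
Σ<-split zero L f = refl
Σ<-split (suc a) L f = trans (cong (f 0 +_) (Σ<-split a L (λ i → f (suc i)))) (sym (+-assoc (f 0) _ _))

Σ<-splitAt : ∀ {m M} (f : ℕ → ℕ) → m ≤ M → Σ< M f ≡ Σ< m f + Σ< (M ∸ m) (λ i → f (m + i))
Σ<-splitAt {m} {M} f m≤M = trans (cong (λ z → Σ< z f) (sym (m+[n∸m]≡n m≤M))) (Σ<-split m (M ∸ m) f)

Σ<-swap : ∀ N M (f : ℕ → ℕ → ℕ) → Σ< N (λ x → Σ< M (f x)) ≡ Σ< M (λ y → Σ< N (λ x → f x y))
Σ<-swap N M f = begin
  Σ< N (λ x → Σ< M (f x))                       ≡⟨ ΣF-toℕ {N} (λ x → Σ< M (f x)) ⟨
  ΣF {N} (λ x → Σ< M (f (toℕ x)))               ≡⟨ ΣF-cong {N} (λ x → sym (ΣF-toℕ {M} (f (toℕ x)))) ⟩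
  ΣF {N} (λ x → ΣF {M} (λ y → f (toℕ x) (toℕ y))) ≡⟨ ΣF-swap {N} {M} (λ x y → f (toℕ x) (toℕ y)) ⟩
  ΣF {M} (λ y → ΣF {N} (λ x → f (toℕ x) (toℕ y))) ≡⟨ ΣF-cong {M} (λ y → ΣF-toℕ {N} (λ x → f x (toℕ y))) ⟩
  ΣF {M} (λ y → Σ< N (λ x → f x (toℕ y)))       ≡⟨ ΣF-toℕ {M} (λ y → Σ< N (λ x → f x y)) ⟩
  Σ< M (λ y → Σ< N (λ x → f x y))               ∎

Σ<-restrict : ∀ M m (f : ℕ → ℕ) → m ≤ M → Σ< M (λ d → 𝟙 (d <ᵇ m) * f d) ≡ Σ< m f
Σ<-restrict M m f m≤M = begin
  Σ< M (λ d → 𝟙 (d <ᵇ m) * f d)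
    ≡⟨ Σ<-splitAt (λ d → 𝟙 (d <ᵇ m) * f d) m≤M ⟩
  Σ< m (λ d → 𝟙 (d <ᵇ m) * f d) + Σ< (M ∸ m) (λ i → 𝟙 (m + i <ᵇ m) * f (m + i))
    ≡⟨ cong₂ _+_ (Σ<-cong< m (λ d d<m → trans (cong (λ b → 𝟙 b * f d) (<⇒<ᵇ-true d<m)) (+-identityʳ (f d))))
                 (Σ<-zero (M ∸ m) _ (λ i _ → cong (λ b → 𝟙 b * f (m + i)) (notBelow i))) ⟩
  Σ< m f + 0
    ≡⟨ +-identityʳ _ ⟩
  Σ< m f ∎
  where
  notBelow : ∀ i → (m + i <ᵇ m) ≡ false
  notBelow i with m + i <ᵇ m in e
  ... | false = refl
  ... | true = ⊥-elim (<⇒≱ (<ᵇ-true⇒< (m + i) m e) (m≤m+n m i))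

Σ<-shift : ∀ N g (f : ℕ → ℕ) → Σ< N (λ h → 𝟙 (g <ᵇ h) * f h) ≡ Σ< (N ∸ suc g) (λ d → f (suc g + d))
Σ<-shift zero g f = refl
Σ<-shift (suc N) zero f = Σ<-cong N (λ h → +-identityʳ (f (suc h)))
Σ<-shift (suc N) (suc g) f = Σ<-shift N g (λ h → f (suc h))

sumRange-Σ< : ∀ a b f → sumRange a b f ≡ Σ< (suc b ∸ a) (λ i → f (a + i))
sumRange-Σ< a b f = listSum (suc b ∸ a) (λ i → i)
  where
  listSum : ∀ m (g : ℕ → ℕ) → sum (map (λ i → f (a + i)) (applyUpTo g m)) ≡ Σ< m (λ i → f (a + g i))
  listSum zero g = refl
  listSum (suc m) g = cong (f (a + g 0) +_) (listSum m (λ i → g (suc i)))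

inRange : ∀ a b i → i < suc b ∸ a → a + i ≤ b
inRange a b i lt with a ≤? suc b
... | yes a≤ = ≤-pred (subst (_≤ suc b) (cong suc (+-comm i a)) (m≤o∸n⇒m+n≤o (suc i) a≤ lt))
... | no a≰ with subst (i <_) (m≤n⇒m∸n≡0 (<⇒≤ (≰⇒> a≰))) lt
...   | ()

sumRange-cong : ∀ a b {f g : ℕ → ℕ} → (∀ i → a ≤ i → i ≤ b → f i ≡ g i) → sumRange a b f ≡ sumRange a b g
sumRange-cong a b {f} {g} h = begin
  sumRange a b f                         ≡⟨ sumRange-Σ< a b f ⟩
  Σ< (suc b ∸ a) (λ i → f (a + i))       ≡⟨ Σ<-cong< (suc b ∸ a) (λ i lt → h (a + i) (m≤m+n a i) (inRange a b i lt)) ⟩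
  Σ< (suc b ∸ a) (λ i → g (a + i))       ≡⟨ sumRange-Σ< a b g ⟨
  sumRange a b g                         ∎

window : ∀ M a b (f : ℕ → ℕ) → b < M → (∀ i → i < a → f i ≡ 0) → (∀ i → b < i → f i ≡ 0) →
  Σ< M f ≡ sumRange a b f
window M a b f b<M below above with a ≤? suc b
... | yes a≤sb = begin
  Σ< M f
    ≡⟨ Σ<-splitAt f b<M ⟩
  Σ< (suc b) f + Σ< (M ∸ suc b) (λ i → f (suc b + i))
    ≡⟨ cong₂ _+_ (Σ<-splitAt f a≤sb) (Σ<-zero (M ∸ suc b) _ (λ i _ → above (suc b + i) (m≤m+n (suc b) i))) ⟩
  (Σ< a f + Σ< (suc b ∸ a) (λ i → f (a + i))) + 0
    ≡⟨ cong (λ z → (z + Σ< (suc b ∸ a) (λ i → f (a + i))) + 0) (Σ<-zero a f below) ⟩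
  Σ< (suc b ∸ a) (λ i → f (a + i)) + 0
    ≡⟨ +-identityʳ _ ⟩
  Σ< (suc b ∸ a) (λ i → f (a + i))
    ≡⟨ sumRange-Σ< a b f ⟨
  sumRange a b f ∎
... | no a≰sb = trans (Σ<-zero M f vanish) (sym emptyRange)
  where
  b<a : suc b < a
  b<a = ≰⇒> a≰sb
  vanish : ∀ i → i < M → f i ≡ 0
  vanish i _ with i ≤? b
  ... | yes i≤b = below i (<-trans (s≤s i≤b) b<a)
  ... | no i≰b = above i (≰⇒> i≰b)
  emptyRange : sumRange a b f ≡ 0
  emptyRange rewrite sumRange-Σ< a b f | m≤n⇒m∸n≡0 (<⇒≤ b<a) = refl

-- The final substitution h = g + 1 + d, ℓ = g.  With N = 2n points and
-- D = N - 2 - 2q - 2r, the sum over g < h becomes a sum over the gap d and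
-- the left end ℓ; terms with ℓ < 2q or with fewer than 2r points right of h
-- vanish, which cuts the ranges down to those of the formula.

module Reindexing (n q r : ℕ) (hn : 1 ≤ n) (hqr : q + r ≤ n ∸ 1) where

  N K D : ℕ
  N = 2 * n
  K = perf (N ∸ 2 ∸ 2 * q ∸ 2 * r)
  D = N ∸ 2 ∸ 2 * q ∸ 2 * r

  pairValue : ℕ → ℕ → ℕ
  pairValue g h = part g q * part (N ∸ suc h) r * K

  -- the pair {g, g + 1 + d}, if it fits among the N points
  gapValue : ℕ → ℕ → ℕ
  gapValue g d = 𝟙 (d <ᵇ N ∸ suc g) * pairValue g (suc g + d)

  U : ℕ → ℕ → ℕ
  U ℓ d = (ℓ C (2 * q)) * oddDF q * ((2 * n ∸ d ∸ ℓ ∸ 2) C (2 * r)) * oddDF r * oddDF (n ∸ 1 ∸ q ∸ r)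

  Lmax : ℕ → ℕ
  Lmax d = 2 * n ∸ d ∸ 2 ∸ 2 * r

  room : 2 + 2 * q + 2 * r ≤ N
  room = subst (_≤ N) (double q r) (*-monoʳ-≤ 2 (m≤o∸n⇒m+n≤o (q + r) hn hqr))
    where double : ∀ q r → 2 * (q + r + 1) ≡ 2 + 2 * q + 2 * r
          double = solve-∀

  D≡ : D ≡ N ∸ (2 + 2 * q + 2 * r)
  D≡ = trans (∸-+-assoc (N ∸ 2) (2 * q) (2 * r))
             (trans (∸-+-assoc N 2 (2 * q + 2 * r)) (cong (N ∸_) (sym (+-assoc 2 (2 * q) (2 * r)))))

  Lmax≡ : ∀ d → Lmax d ≡ N ∸ (d + 2 + 2 * r)
  Lmax≡ d = trans (∸-+-assoc (N ∸ d) 2 (2 * r)) (trans (∸-+-assoc N d (2 + 2 * r)) (cong (N ∸_) (sym (+-assoc d 2 (2 * r)))))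

  D<N : D < N
  D<N = subst (_< N) (sym D≡) (∸-monoʳ-< z<s room)

  reach : ∀ d → d ≤ D → d + 2 + 2 * r ≤ N
  reach d d≤D = ≤-trans (subst (d + 2 + 2 * r ≤_) (reorder d q r) (m≤m+n (d + 2 + 2 * r) (2 * q)))
                        (m≤o∸n⇒m+n≤o d room (subst (d ≤_) D≡ d≤D))
    where reorder : ∀ d q r → d + 2 + 2 * r + 2 * q ≡ d + (2 + 2 * q + 2 * r)
          reorder = solve-∀

  Lmax<N : ∀ d → d ≤ D → Lmax d < N
  Lmax<N d d≤D = subst (_< N) (sym (Lmax≡ d)) (∸-monoʳ-< (subst (0 <_) (positive d r) z<s) (reach d d≤D))
    where positive : ∀ d r → suc (d + 1 + 2 * r) ≡ d + 2 + 2 * r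
          positive = solve-∀

  fits⇒ : ∀ g d → (d <ᵇ N ∸ suc g) ≡ true → suc (suc g + d) ≤ N
  fits⇒ g d e with suc g ≤? N
  ... | yes g<N = subst (_≤ N) (cong suc (+-comm d (suc g))) (m≤o∸n⇒m+n≤o (suc d) g<N (<ᵇ-true⇒< d (N ∸ suc g) e))
  ... | no g≮N with subst (d <_) (m≤n⇒m∸n≡0 (<⇒≤ (≰⇒> g≮N))) (<ᵇ-true⇒< d (N ∸ suc g) e)
  ...   | ()

  ⇒fits : ∀ ℓ d → d ≤ D → ℓ ≤ Lmax d → (d <ᵇ N ∸ suc ℓ) ≡ true
  ⇒fits ℓ d d≤D ℓ≤ = <⇒<ᵇ-true (m+n≤o⇒m≤o∸n (suc d) (≤-trans (subst (suc d + suc ℓ ≤_) (reorder ℓ d r)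
                         (m≤m+n (suc d + suc ℓ) (2 * r))) (m≤o∸n⇒m+n≤o ℓ (reach d d≤D) (subst (ℓ ≤_) (Lmax≡ d) ℓ≤))))
    where reorder : ∀ ℓ d r → suc d + suc ℓ + 2 * r ≡ ℓ + (d + 2 + 2 * r)
          reorder = solve-∀

  rightShort : ∀ g d → (d <ᵇ N ∸ suc g) ≡ true → N < g + d + 2 + 2 * r → N ∸ suc (suc g + d) < 2 * r
  rightShort g d e tooFar = ≰⇒> (λ 2r≤ → <⇒≱ tooFar (subst (_≤ N) (reorder g d r) (m≤o∸n⇒m+n≤o (2 * r) (fits⇒ g d e) 2r≤)))
    where reorder : ∀ g d r → 2 * r + suc (suc g + d) ≡ g + d + 2 + 2 * r
          reorder = solve-∀

  vanish : ∀ g d → (g < 2 * q) ⊎ (N < g + d + 2 + 2 * r) → gapValue g d ≡ 0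
  vanish g d (inj₁ g<2q) rewrite part-zero g q g<2q = *-zeroʳ (𝟙 (d <ᵇ N ∸ suc g))
  vanish g d (inj₂ tooFar) with d <ᵇ N ∸ suc g in e
  ... | false = refl
  ... | true = begin
    1 * (part g q * part (N ∸ suc (suc g + d)) r * K) ≡⟨ *-identityˡ _ ⟩
    part g q * part (N ∸ suc (suc g + d)) r * K     ≡⟨ cong (λ z → part g q * z * K) (part-zero _ r (rightShort g d e tooFar)) ⟩
    part g q * 0 * K                               ≡⟨ cong (_* K) (*-zeroʳ (part g q)) ⟩
    0                                              ∎

  K≡ : K ≡ oddDF (n ∸ 1 ∸ q ∸ r)
  K≡ = trans (cong perf (sym doubled)) (perf-even (n ∸ 1 ∸ q ∸ r))
    where
    doubled : 2 * (n ∸ 1 ∸ q ∸ r) ≡ N ∸ 2 ∸ 2 * q ∸ 2 * r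
    doubled = trans (*-distribˡ-∸ 2 (n ∸ 1 ∸ q) r)
              (cong (_∸ 2 * r) (trans (*-distribˡ-∸ 2 (n ∸ 1) q) (cong (_∸ 2 * q) (*-distribˡ-∸ 2 n 1))))

  right≡ : ∀ ℓ d → 2 * n ∸ d ∸ ℓ ∸ 2 ≡ N ∸ suc (suc ℓ + d)
  right≡ ℓ d = trans (∸-+-assoc (N ∸ d) ℓ 2) (trans (∸-+-assoc N d (ℓ + 2)) (cong (N ∸_) (reorder ℓ d)))
    where reorder : ∀ ℓ d → d + (ℓ + 2) ≡ suc (suc ℓ + d)
          reorder = solve-∀

  pairValue≡U : ∀ ℓ d → pairValue ℓ (suc ℓ + d) ≡ U ℓ d
  pairValue≡U ℓ d = begin
    part ℓ q * part (N ∸ suc (suc ℓ + d)) r * K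
      ≡⟨ cong₂ (λ x y → x * y * K) (part≡C ℓ q) (part≡C (N ∸ suc (suc ℓ + d)) r) ⟩
    (ℓ C (2 * q)) * oddDF q * (((N ∸ suc (suc ℓ + d)) C (2 * r)) * oddDF r) * K
      ≡⟨ cong₂ (λ x k → (ℓ C (2 * q)) * oddDF q * ((x C (2 * r)) * oddDF r) * k) (sym (right≡ ℓ d)) K≡ ⟩
    (ℓ C (2 * q)) * oddDF q * (((2 * n ∸ d ∸ ℓ ∸ 2) C (2 * r)) * oddDF r) * oddDF (n ∸ 1 ∸ q ∸ r)
      ≡⟨ reassoc (ℓ C (2 * q)) (oddDF q) ((2 * n ∸ d ∸ ℓ ∸ 2) C (2 * r)) (oddDF r) (oddDF (n ∸ 1 ∸ q ∸ r)) ⟩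
    U ℓ d ∎
    where reassoc : ∀ a b c e f → a * b * (c * e) * f ≡ a * b * c * e * f
          reassoc = solve-∀

  inner : ∀ d → d ≤ D → Σ< N (λ g → gapValue g d) ≡ sumRange (2 * q) (Lmax d) (λ ℓ → U ℓ d)
  inner d d≤D = begin
    Σ< N (λ g → gapValue g d)
      ≡⟨ window N (2 * q) (Lmax d) (λ g → gapValue g d) (Lmax<N d d≤D)
                (λ g g<2q → vanish g d (inj₁ g<2q)) (λ g Lmax<g → vanish g d (inj₂ (beyond g Lmax<g))) ⟩
    sumRange (2 * q) (Lmax d) (λ ℓ → gapValue ℓ d)
      ≡⟨ sumRange-cong (2 * q) (Lmax d) (λ ℓ _ ℓ≤ → inWindow ℓ ℓ≤) ⟩
    sumRange (2 * q) (Lmax d) (λ ℓ → U ℓ d) ∎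
    where
    beyond : ∀ g → Lmax d < g → N < g + d + 2 + 2 * r
    beyond g Lmax<g = ≰⇒> (λ g≤ → <⇒≱ Lmax<g (subst (g ≤_) (sym (Lmax≡ d))
                        (m+n≤o⇒m≤o∸n g (subst (_≤ N) (reassoc g d r) g≤))))
      where reassoc : ∀ g d r → g + d + 2 + 2 * r ≡ g + (d + 2 + 2 * r)
            reassoc = solve-∀
    inWindow : ∀ ℓ → ℓ ≤ Lmax d → gapValue ℓ d ≡ U ℓ d
    inWindow ℓ ℓ≤ rewrite ⇒fits ℓ d d≤D ℓ≤ = trans (+-identityʳ _) (pairValue≡U ℓ d)

  outer : Σ< N (λ d → Σ< N (λ g → gapValue g d)) ≡ sumRange 0 D (λ d → Σ< N (λ g → gapValue g d))
  outer = window N 0 D (λ d → Σ< N (λ g → gapValue g d)) D<N (λ _ ())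
            (λ d D<d → Σ<-zero N (λ g → gapValue g d) (λ g _ → vanish g d (tooLong g d D<d)))
    where
    tooLong : ∀ g d → D < d → (g < 2 * q) ⊎ (N < g + d + 2 + 2 * r)
    tooLong g d D<d with g <? 2 * q
    ... | yes g<2q = inj₁ g<2q
    ... | no g≮2q = inj₂ (≰⇒> (λ g≤ → <⇒≱ D<d (subst (d ≤_) (sym D≡) (m+n≤o⇒m≤o∸n d (≤-trans (shifted g≮2q) g≤)))))
      where
      reorder : ∀ d q r → d + (2 + 2 * q + 2 * r) ≡ 2 * q + (d + 2 + 2 * r)
      reorder = solve-∀
      reorder′ : ∀ g d r → g + (d + 2 + 2 * r) ≡ g + d + 2 + 2 * r
      reorder′ = solve-∀
      shifted : ¬ g < 2 * q → d + (2 + 2 * q + 2 * r) ≤ g + d + 2 + 2 * r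
      shifted g≮ = subst₂ _≤_ (sym (reorder d q r)) (reorder′ g d r) (+-monoˡ-≤ (d + 2 + 2 * r) (≮⇒≥ g≮))

  byGap : Σ< N (λ g → Σ< N (λ h → 𝟙 (g <ᵇ h) * pairValue g h)) ≡ Σ< N (λ d → Σ< N (λ g → gapValue g d))
  byGap = begin
    Σ< N (λ g → Σ< N (λ h → 𝟙 (g <ᵇ h) * pairValue g h))
      ≡⟨ Σ<-cong N (λ g → Σ<-shift N g (pairValue g)) ⟩
    Σ< N (λ g → Σ< (N ∸ suc g) (λ d → pairValue g (suc g + d)))
      ≡⟨ Σ<-cong N (λ g → sym (Σ<-restrict N (N ∸ suc g) (λ d → pairValue g (suc g + d)) (m∸n≤m N (suc g)))) ⟩
    Σ< N (λ g → Σ< N (λ d → gapValue g d))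
      ≡⟨ Σ<-swap N N gapValue ⟩
    Σ< N (λ d → Σ< N (λ g → gapValue g d)) ∎

  gapSum≡formula : Σ< N (λ g → Σ< N (λ h → 𝟙 (g <ᵇ h) * pairValue g h)) ≡ formula n q r
  gapSum≡formula = begin
    Σ< N (λ g → Σ< N (λ h → 𝟙 (g <ᵇ h) * pairValue g h))
      ≡⟨ byGap ⟩
    Σ< N (λ d → Σ< N (λ g → gapValue g d))
      ≡⟨ outer ⟩
    sumRange 0 D (λ d → Σ< N (λ g → gapValue g d))
      ≡⟨ sumRange-cong 0 D (λ d _ d≤D → inner d d≤D) ⟩
    formula n q r ∎

proposition22 : (n q r : ℕ) → 1 ≤ n → q + r ≤ n ∸ 1 → Y n q r ≡ formula n q r
proposition22 n q r hn hqr = begin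
  Y n q r
    ≡⟨ configurationSum-gaps ⟩
  ΣF (λ g → ΣF (λ h → 𝟙 (ltL g h) * gapTerm g h))
    ≡⟨ ΣF-cong {2 * n} (λ g → ΣF-toℕ {2 * n} (λ h → 𝟙 (toℕ g <ᵇ h) * pairValue (toℕ g) h)) ⟩
  ΣF {2 * n} (λ g → Σ< N (λ h → 𝟙 (toℕ g <ᵇ h) * pairValue (toℕ g) h))
    ≡⟨ ΣF-toℕ {2 * n} (λ g → Σ< N (λ h → 𝟙 (g <ᵇ h) * pairValue g h)) ⟩
  Σ< N (λ g → Σ< N (λ h → 𝟙 (g <ᵇ h) * pairValue g h))
    ≡⟨ gapSum≡formula ⟩
  formula n q r ∎
  where
  open Configurations (2 * n) q r
  open Reindexing n q r hn hqr
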